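{- For a finite simple graph $G$ the following are equivalent: (i) $G$ is a König–Egerváry graph; (ii) $\mathrm{diadem}(G)=\mathrm{corona}(G)$ and $|\mathrm{core}(G)|+|\mathrm{corona}(G)|=2\alpha(G)$; (iii) $\mathrm{corona}(G)$ is a critical set and $|\mathrm{core}(G)|+|\mathrm{corona}(G)|=2\alpha(G)$.
   Context: For $X\subseteq V(G)$, $N(X)$ is the set of vertices adjacent to some vertex of $X$, $d(X)=|X|-|N(X)|$, $d(G)=\max\{d(X):X\subseteq V(G)\}$, and $X$ is critical if $d(X)=d(G)$. An independent set $A$ is a critical independent set if $d(A)=\max\{d(I): I \text{ independent}\}$; $\mathrm{diadem}(G)$ is the union of all critical independent sets. $\alpha(G)$ is the independence number, $\Omega(G)$ the family of maximum independent sets, $\mathrm{core}(G)=\bigcap\Omega(G)$, $\mathrm{corona}(G)=\bigcup\Omega(G)$. $\mu(G)$ is the matching number; $G$ is König–Egerváry if $\alpha(G)+\mu(G)=|V(G)|$. -}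

module Defs where

open import Data.Nat as ℕ using (ℕ; zero; suc)
open import Data.Integer as ℤ using (ℤ; +_; _-_; _⊔_)
open import Data.Bool using (Bool; true; false; _∧_; _∨_; not; if_then_else_)
open import Data.Fin using (Fin; zero; suc)
open import Data.Fin.Subset using (Subset; ∣_∣)
open import Data.Vec using (Vec; []; _∷_; lookup; tabulate)
open import Data.List using (List; []; _∷_; _++_; map; filter; foldr; length; concatMap)
open import Data.List.Relation.Unary.All using (All)
open import Data.List.Relation.Unary.Unique.Propositional using (Unique)
open import Data.Product using (_×_; _,_; proj₁; proj₂; ∃; Σ)
open import Relation.Binary.PropositionalEquality using (_≡_)
open import Function using (_∘_)

record Graph (n : ℕ) : Set where
  field
    adj    : Fin n → Fin n → Bool
    sym    : ∀ i j → adj i j ≡ adj j i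
    irrefl : ∀ i → adj i i ≡ false
open Graph public

anyFin : ∀ {n} → (Fin n → Bool) → Bool
anyFin {zero}  f = false
anyFin {suc n} f = f zero ∨ anyFin (f ∘ suc)

allFin : ∀ {n} → (Fin n → Bool) → Bool
allFin {zero}  f = true
allFin {suc n} f = f zero ∧ allFin (f ∘ suc)

subsets : (n : ℕ) → List (Subset n)
subsets zero    = [] ∷ []
subsets (suc n) = map (true ∷_) (subsets n) ++ map (false ∷_) (subsets n)

anyL : ∀ {A : Set} → (A → Bool) → List A → Bool
anyL p = foldr (λ x b → p x ∨ b) false

allL : ∀ {A : Set} → (A → Bool) → List A → Bool
allL p = foldr (λ x b → p x ∧ b) true

maxℕ : List ℕ → ℕ
maxℕ = foldr ℕ._⊔_ 0

-- maximum of a list of integers; 0 for the empty list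
-- (only used on lists containing d(∅) = 0, so this is the true maximum)
maxℤ : List ℤ → ℤ
maxℤ = foldr _⊔_ (+ 0)

module _ {n : ℕ} (G : Graph n) where

  N : Subset n → Subset n
  N X = tabulate λ v → anyFin λ u → lookup X u ∧ adj G u v

  d : Subset n → ℤ
  d X = + ∣ X ∣ - + ∣ N X ∣

  dG : ℤ
  dG = maxℤ (map d (subsets n))

  Critical : Subset n → Set
  Critical X = d X ≡ dG

  independent? : Subset n → Bool
  independent? S = allFin λ u → allFin λ v → not (lookup S u ∧ lookup S v ∧ adj G u v)

  indepSets : List (Subset n)
  indepSets = filter (λ S → Data.Bool.T? (independent? S)) (subsets n)
    where import Data.Bool

  α : ℕ
  α = maxℕ (map ∣_∣ indepSets)

  isMaxIndep? : Subset n → Bool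
  isMaxIndep? S = independent? S ∧ (∣ S ∣ ℕ.≡ᵇ α)

  core : Subset n
  core = tabulate λ v → allL (λ S → not (isMaxIndep? S) ∨ lookup S v) (subsets n)

  corona : Subset n
  corona = tabulate λ v → anyL (λ S → isMaxIndep? S ∧ lookup S v) (subsets n)

  dIndep : ℤ
  dIndep = maxℤ (map d indepSets)

  isCritIndep? : Subset n → Bool
  isCritIndep? A = independent? A ∧ ⌊ d A ℤ.≟ dIndep ⌋
    where open import Relation.Nullary.Decidable using (⌊_⌋)

  diadem : Subset n
  diadem = tabulate λ v → anyL (λ A → isCritIndep? A ∧ lookup A v) (subsets n)

  IsMatching : List (Fin n × Fin n) → Set
  IsMatching M = All (λ e → adj G (proj₁ e) (proj₂ e) ≡ true) M
               × Unique (concatMap (λ e → proj₁ e ∷ proj₂ e ∷ []) M)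

  IsMatchingNumber : ℕ → Set
  IsMatchingNumber k = (Σ (List (Fin n × Fin n)) λ M → IsMatching M × length M ≡ k)
                     × (∀ M → IsMatching M → length M ℕ.≤ k)

  KönigEgerváry : Set
  KönigEgerváry = ∃ λ μ → IsMatchingNumber μ × α ℕ.+ μ ≡ n

-- Write δ = 2α − n. A maximum independent set S has |N(S)| ≤ n − α, so δ ≤ d(S) ≤ dIndep ≤ d(G)
-- in every graph. If G is König–Egerváry, a maximum matching M (of size n − α) maps X ∩ V(M)
-- injectively into N(X) and leaves n − 2μ vertices uncovered, so d(X) ≤ δ for all X. Conversely,
-- dIndep ≤ δ yields Hall's condition from V ∖ S into S, and Hall's theorem a matching of size n − α.
-- So G is König–Egerváry iff dIndep ≤ δ, and then d(G) = dIndep = δ.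
-- By supermodularity of d, unions of critical sets are critical and d(diadem) ≥ dIndep; and since
-- N(corona) = V ∖ core, the equation |core| + |corona| = 2α says exactly d(corona) = δ. This gives
-- (iii) ⇒ (i) as dIndep ≤ d(G) = d(corona) = δ, and (ii) ⇒ (i) as dIndep ≤ d(diadem) = d(corona) = δ.
-- For (i) ⇒ (ii), (iii): every maximum independent set is critical, hence so is the corona, which
-- therefore lies in the diadem; and a critical independent set A lies in the maximum independent
-- set A ∪ (S ∖ N(A)), so the diadem lies in the corona.

module Submission where

open import Defs renaming (sym to adj-sym; irrefl to adj-irrefl)

open import Data.Bool using (Bool; true; false; _∧_; _∨_; not; T?; if_then_else_)
open import Data.Bool.Properties using (T-≡; not-injective; ∨-conicalˡ; ∨-conicalʳ)
open import Data.Empty using (⊥-elim)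
open import Data.Fin as Fin using (Fin)
import Data.Fin.Properties as Finₚ
open import Data.Fin.Subset
  using (Subset; ∣_∣; _∩_; _∪_; ∁; ⁅_⁆; _∈_; _∉_; _⊆_; ⊥; Nonempty; Empty)
open import Data.Fin.Subset.Properties
open import Data.Integer as ℤ using (ℤ)
import Data.Integer.Properties as ℤ
open import Data.Integer.Solver using (module +-*-Solver)
open import Data.List using (List; []; _∷_; length; map; concatMap)
import Data.List.Properties as List
open import Data.List.Membership.Propositional using () renaming (_∈_ to _∈ₗ_)
open import Data.List.Membership.Propositional.Properties
  using (∈-map⁺; ∈-map⁻; ∈-++⁺ˡ; ∈-++⁺ʳ; ∈-filter⁺; ∈-filter⁻; foldr-selective)
open import Data.List.Relation.Unary.All as All using (All; []; _∷_)
import Data.List.Relation.Unary.All.Properties as Allₚ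
open import Data.List.Relation.Unary.AllPairs using ([]; _∷_)
open import Data.List.Relation.Unary.Any using (here; there)
open import Data.List.Relation.Unary.Unique.Propositional using (Unique)
import Data.List.Relation.Unary.Unique.Propositional.Properties as Uniqueₚ
open import Data.Nat using (ℕ; zero; suc; _+_; _*_; _∸_; _≤_; _<_; z≤n; s≤s)
import Data.Nat as ℕ
import Data.Nat.Properties as ℕ
open import Data.Product using (_×_; _,_; proj₁; proj₂; ∃)
open import Data.Sum using (_⊎_; inj₁; inj₂)
open import Data.Vec using ([]; _∷_; here; there; lookup; tabulate)
open import Data.Vec.Properties using (lookup⇒[]=; []=⇒lookup; lookup∘tabulate)
open import Function using (_∘_; case_of_)
open import Function.Bundles using (_⇔_; mk⇔; Equivalence)
open import Relation.Binary.PropositionalEquality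
  using (_≡_; _≢_; refl; sym; trans; cong; cong₂; subst; subst₂; module ≡-Reasoning)
open import Relation.Nullary using (¬_; yes; no; Dec; _×-dec_)

private variable n : ℕ

-- Counting subsets of Fin n

∣p∪q∣+∣p∩q∣≡∣p∣+∣q∣ : (p q : Subset n) → ∣ p ∪ q ∣ + ∣ p ∩ q ∣ ≡ ∣ p ∣ + ∣ q ∣
∣p∪q∣+∣p∩q∣≡∣p∣+∣q∣ [] [] = refl
∣p∪q∣+∣p∩q∣≡∣p∣+∣q∣ (true ∷ p) (true ∷ q)
  rewrite ℕ.+-suc ∣ p ∪ q ∣ ∣ p ∩ q ∣ | ℕ.+-suc ∣ p ∣ ∣ q ∣ = cong (suc ∘ suc) (∣p∪q∣+∣p∩q∣≡∣p∣+∣q∣ p q)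
∣p∪q∣+∣p∩q∣≡∣p∣+∣q∣ (true ∷ p) (false ∷ q) = cong suc (∣p∪q∣+∣p∩q∣≡∣p∣+∣q∣ p q)
∣p∪q∣+∣p∩q∣≡∣p∣+∣q∣ (false ∷ p) (true ∷ q)
  rewrite ℕ.+-suc ∣ p ∣ ∣ q ∣ = cong suc (∣p∪q∣+∣p∩q∣≡∣p∣+∣q∣ p q)
∣p∪q∣+∣p∩q∣≡∣p∣+∣q∣ (false ∷ p) (false ∷ q) = ∣p∪q∣+∣p∩q∣≡∣p∣+∣q∣ p q

∣p∩q∣+∣p∩∁q∣≡∣p∣ : (p q : Subset n) → ∣ p ∩ q ∣ + ∣ p ∩ ∁ q ∣ ≡ ∣ p ∣
∣p∩q∣+∣p∩∁q∣≡∣p∣ [] [] = refl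
∣p∩q∣+∣p∩∁q∣≡∣p∣ (true ∷ p) (true ∷ q) = cong suc (∣p∩q∣+∣p∩∁q∣≡∣p∣ p q)
∣p∩q∣+∣p∩∁q∣≡∣p∣ (true ∷ p) (false ∷ q)
  rewrite ℕ.+-suc ∣ p ∩ q ∣ ∣ p ∩ ∁ q ∣ = cong suc (∣p∩q∣+∣p∩∁q∣≡∣p∣ p q)
∣p∩q∣+∣p∩∁q∣≡∣p∣ (false ∷ p) (_ ∷ q) = ∣p∩q∣+∣p∩∁q∣≡∣p∣ p q

∣p∪q∣≤∣p∣+∣q∣ : (p q : Subset n) → ∣ p ∪ q ∣ ≤ ∣ p ∣ + ∣ q ∣
∣p∪q∣≤∣p∣+∣q∣ p q = subst (∣ p ∪ q ∣ ≤_) (∣p∪q∣+∣p∩q∣≡∣p∣+∣q∣ p q) (ℕ.m≤m+n _ _)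

Empty⇒∣p∣≡0 : {p : Subset n} → Empty p → ∣ p ∣ ≡ 0
Empty⇒∣p∣≡0 {n} e rewrite Empty-unique e = ∣⊥∣≡0 n

Disjoint⇒∣p∪q∣≡∣p∣+∣q∣ : (p q : Subset n) → Empty (p ∩ q) → ∣ p ∪ q ∣ ≡ ∣ p ∣ + ∣ q ∣
Disjoint⇒∣p∪q∣≡∣p∣+∣q∣ p q e = begin
  ∣ p ∪ q ∣               ≡⟨ sym (ℕ.+-identityʳ _) ⟩
  ∣ p ∪ q ∣ + 0           ≡⟨ cong (_+_ ∣ p ∪ q ∣) (sym (Empty⇒∣p∣≡0 e)) ⟩
  ∣ p ∪ q ∣ + ∣ p ∩ q ∣   ≡⟨ ∣p∪q∣+∣p∩q∣≡∣p∣+∣q∣ p q ⟩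
  ∣ p ∣ + ∣ q ∣           ∎
  where open ≡-Reasoning

∣p∣>0⇒Nonempty : (p : Subset n) → 0 < ∣ p ∣ → Nonempty p
∣p∣>0⇒Nonempty p pos with nonempty? p
... | yes ne = ne
... | no e = ⊥-elim (ℕ.<⇒≢ pos (sym (Empty⇒∣p∣≡0 e)))

∣p∩q∣>0⇒∣p∩∁q∣<∣p∣ : (p q : Subset n) → 0 < ∣ p ∩ q ∣ → ∣ p ∩ ∁ q ∣ < ∣ p ∣
∣p∩q∣>0⇒∣p∩∁q∣<∣p∣ p q pos =
  subst (∣ p ∩ ∁ q ∣ <_) (∣p∩q∣+∣p∩∁q∣≡∣p∣ p q) (ℕ.m<n+m ∣ p ∩ ∁ q ∣ pos)

x∈p⇒∣p∩∁⁅x⁆∣<∣p∣ : {x : Fin n} {p : Subset n} → x ∈ p → ∣ p ∩ ∁ ⁅ x ⁆ ∣ < ∣ p ∣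
x∈p⇒∣p∩∁⁅x⁆∣<∣p∣ {x = x} {p} x∈p = ∣p∩q∣>0⇒∣p∩∁q∣<∣p∣ p ⁅ x ⁆
  (subst (_≤ ∣ p ∩ ⁅ x ⁆ ∣) (∣⁅x⁆∣≡1 x) (p⊆q⇒∣p∣≤∣q∣ λ y∈⁅x⁆ →
    x∈p∩q⁺ (subst (_∈ p) (sym (x∈⁅y⁆⇒x≡y x y∈⁅x⁆)) x∈p , y∈⁅x⁆)))

∣p∣≤1+∣p∩∁⁅x⁆∣ : (x : Fin n) (p : Subset n) → ∣ p ∣ ≤ suc ∣ p ∩ ∁ ⁅ x ⁆ ∣
∣p∣≤1+∣p∩∁⁅x⁆∣ x p = begin
  ∣ p ∣                              ≡⟨ sym (∣p∩q∣+∣p∩∁q∣≡∣p∣ p ⁅ x ⁆) ⟩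
  ∣ p ∩ ⁅ x ⁆ ∣ + ∣ p ∩ ∁ ⁅ x ⁆ ∣    ≤⟨ ℕ.+-monoˡ-≤ _ (subst (∣ p ∩ ⁅ x ⁆ ∣ ≤_) (∣⁅x⁆∣≡1 x) (∣p∩q∣≤∣q∣ p ⁅ x ⁆)) ⟩
  suc ∣ p ∩ ∁ ⁅ x ⁆ ∣                ∎
  where open ℕ.≤-Reasoning

p⊆q∪[p∩∁q] : (p q : Subset n) → p ⊆ q ∪ p ∩ ∁ q
p⊆q∪[p∩∁q] p q {x} x∈p with x ∈? q
... | yes x∈q = x∈p∪q⁺ (inj₁ x∈q)
... | no x∉q  = x∈p∪q⁺ (inj₂ (x∈p∩q⁺ (x∈p , x∉p⇒x∈∁p x∉q)))

[p∩q]∪[p∩∁q]⊆p : (p q : Subset n) → p ∩ q ∪ p ∩ ∁ q ⊆ p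
[p∩q]∪[p∩∁q]⊆p p q x∈ with x∈p∪q⁻ (p ∩ q) (p ∩ ∁ q) x∈
... | inj₁ x∈p∩q  = p∩q⊆p p q x∈p∩q
... | inj₂ x∈p∩∁q = p∩q⊆p p (∁ q) x∈p∩∁q

Unique⇒length≤∣p∣ : (xs : List (Fin n)) (p : Subset n) → Unique xs → All (_∈ p) xs → length xs ≤ ∣ p ∣
Unique⇒length≤∣p∣ [] p _ _ = z≤n
Unique⇒length≤∣p∣ (x ∷ xs) p (x∉xs ∷ uniq) (x∈p ∷ xs⊆p) =
  ℕ.≤-trans (s≤s (Unique⇒length≤∣p∣ xs (p ∩ ∁ ⁅ x ⁆) uniq (All.zipWith remove (x∉xs , xs⊆p))))
            (x∈p⇒∣p∩∁⁅x⁆∣<∣p∣ x∈p)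
  where
  remove : ∀ {y} → x ≢ y × y ∈ p → y ∈ p ∩ ∁ ⁅ x ⁆
  remove (x≢y , y∈p) = x∈p∩q⁺ (y∈p , x∉p⇒x∈∁p (λ y∈⁅x⁆ → x≢y (sym (x∈⁅y⁆⇒x≡y x y∈⁅x⁆))))

elements : Subset n → List (Fin n)
elements []          = []
elements (true ∷ p)  = Fin.zero ∷ map Fin.suc (elements p)
elements (false ∷ p) = map Fin.suc (elements p)

length-elements : (p : Subset n) → length (elements p) ≡ ∣ p ∣
length-elements []          = refl
length-elements (true ∷ p)  = cong suc (trans (List.length-map Fin.suc (elements p)) (length-elements p))
length-elements (false ∷ p) = trans (List.length-map Fin.suc (elements p)) (length-elements p)

∈-elements⁻ : (p : Subset n) {x : Fin n} → x ∈ₗ elements p → x ∈ p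
∈-elements⁻ (true ∷ p) (here refl) = here
∈-elements⁻ (true ∷ p) (there x∈) with ∈-map⁻ Fin.suc x∈
... | _ , y∈ , refl = there (∈-elements⁻ p y∈)
∈-elements⁻ (false ∷ p) x∈ with ∈-map⁻ Fin.suc x∈
... | _ , y∈ , refl = there (∈-elements⁻ p y∈)

elements-unique : (p : Subset n) → Unique (elements p)
elements-unique []          = []
elements-unique (true ∷ p)  = All.tabulate zero∉ ∷ Uniqueₚ.map⁺ Finₚ.suc-injective (elements-unique p)
  where
  zero∉ : ∀ {y} → y ∈ₗ map Fin.suc (elements p) → Fin.zero ≢ y
  zero∉ y∈ refl with ∈-map⁻ Fin.suc y∈
  ... | _ , _ , ()
elements-unique (false ∷ p) = Uniqueₚ.map⁺ Finₚ.suc-injective (elements-unique p)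

InjectiveOn : Subset n → (Fin n → Fin n) → Set
InjectiveOn p f = ∀ {x y} → x ∈ p → y ∈ p → f x ≡ f y → x ≡ y

injectiveOn⇒∣p∣≤∣q∣ : (p q : Subset n) (f : Fin n → Fin n) →
  (∀ {x} → x ∈ p → f x ∈ q) → InjectiveOn p f → ∣ p ∣ ≤ ∣ q ∣
injectiveOn⇒∣p∣≤∣q∣ p q f f∈q f-inj =
  subst (_≤ ∣ q ∣) (trans (List.length-map f (elements p)) (length-elements p))
    (Unique⇒length≤∣p∣ (map f (elements p)) q (map-unique (elements p) (elements-unique p) (∈-elements⁻ p))
                       (Allₚ.map⁺ (All.tabulate (f∈q ∘ ∈-elements⁻ p))))
  where
  map-unique : ∀ xs → Unique xs → (∀ {x} → x ∈ₗ xs → x ∈ p) → Unique (map f xs)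
  map-unique [] _ _ = []
  map-unique (x ∷ xs) (x∉xs ∷ uniq) xs⊆p =
    Allₚ.map⁺ (All.tabulate λ y∈xs fx≡fy → All.lookup x∉xs y∈xs (f-inj (xs⊆p (here refl)) (xs⊆p (there y∈xs)) fx≡fy))
    ∷ map-unique xs uniq (xs⊆p ∘ there)

fromList : List (Fin n) → Subset n
fromList []       = ⊥
fromList (v ∷ vs) = ⁅ v ⁆ ∪ fromList vs

∈-fromList⁺ : ∀ (vs : List (Fin n)) {x} → x ∈ₗ vs → x ∈ fromList vs
∈-fromList⁺ (v ∷ vs) (here refl) = x∈p∪q⁺ (inj₁ (x∈⁅x⁆ v))
∈-fromList⁺ (v ∷ vs) (there x∈)  = x∈p∪q⁺ (inj₂ (∈-fromList⁺ vs x∈))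

∈-fromList⁻ : ∀ (vs : List (Fin n)) {x} → x ∈ fromList vs → x ∈ₗ vs
∈-fromList⁻ []       x∈ = ⊥-elim (∉⊥ x∈)
∈-fromList⁻ (v ∷ vs) x∈ with x∈p∪q⁻ ⁅ v ⁆ (fromList vs) x∈
... | inj₁ x∈⁅v⁆ = here (x∈⁅y⁆⇒x≡y v x∈⁅v⁆)
... | inj₂ x∈vs  = there (∈-fromList⁻ vs x∈vs)

∨≡true⁻ : ∀ a {b} → a ∨ b ≡ true → a ≡ true ⊎ b ≡ true
∨≡true⁻ true  _ = inj₁ refl
∨≡true⁻ false e = inj₂ e

∨≡true⁺ʳ : ∀ a {b} → b ≡ true → a ∨ b ≡ true
∨≡true⁺ʳ true  _ = refl
∨≡true⁺ʳ false e = e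

∧≡true⁺ : ∀ {a b} → a ≡ true → b ≡ true → a ∧ b ≡ true
∧≡true⁺ refl refl = refl

∧≡true⁻ : ∀ a {b} → a ∧ b ≡ true → a ≡ true × b ≡ true
∧≡true⁻ true e = refl , e

anyFin⁻ : (f : Fin n → Bool) → anyFin f ≡ true → ∃ λ i → f i ≡ true
anyFin⁻ {suc n} f e with ∨≡true⁻ (f Fin.zero) e
... | inj₁ f0 = Fin.zero , f0
... | inj₂ rest = let i , fi = anyFin⁻ (f ∘ Fin.suc) rest in Fin.suc i , fi

anyFin⁺ : (f : Fin n → Bool) (i : Fin n) → f i ≡ true → anyFin f ≡ true
anyFin⁺ f Fin.zero    e rewrite e = refl
anyFin⁺ f (Fin.suc i) e = ∨≡true⁺ʳ (f Fin.zero) (anyFin⁺ (f ∘ Fin.suc) i e)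

allFin⁻ : (f : Fin n → Bool) → allFin f ≡ true → ∀ i → f i ≡ true
allFin⁻ f e Fin.zero    = proj₁ (∧≡true⁻ (f Fin.zero) e)
allFin⁻ f e (Fin.suc i) = allFin⁻ (f ∘ Fin.suc) (proj₂ (∧≡true⁻ (f Fin.zero) e)) i

allFin⁺ : (f : Fin n → Bool) → (∀ i → f i ≡ true) → allFin f ≡ true
allFin⁺ {zero}  f _ = refl
allFin⁺ {suc n} f h = ∧≡true⁺ (h Fin.zero) (allFin⁺ (f ∘ Fin.suc) (h ∘ Fin.suc))

module _ {A : Set} (p : A → Bool) where

  anyL⁻ : ∀ xs → anyL p xs ≡ true → ∃ λ x → x ∈ₗ xs × p x ≡ true
  anyL⁻ (x ∷ xs) e with ∨≡true⁻ (p x) e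
  ... | inj₁ px = x , here refl , px
  ... | inj₂ rest = let y , y∈ , py = anyL⁻ xs rest in y , there y∈ , py

  anyL⁺ : ∀ xs {x} → x ∈ₗ xs → p x ≡ true → anyL p xs ≡ true
  anyL⁺ (x ∷ xs) (here refl) e rewrite e = refl
  anyL⁺ (y ∷ xs) (there x∈) e = ∨≡true⁺ʳ (p y) (anyL⁺ xs x∈ e)

  allL⁻ : ∀ xs → allL p xs ≡ true → ∀ {x} → x ∈ₗ xs → p x ≡ true
  allL⁻ (x ∷ xs) e (here refl) = proj₁ (∧≡true⁻ (p x) e)
  allL⁻ (y ∷ xs) e (there x∈) = allL⁻ xs (proj₂ (∧≡true⁻ (p y) e)) x∈

  allL≡false⁻ : ∀ xs → allL p xs ≡ false → ∃ λ x → x ∈ₗ xs × p x ≡ false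
  allL≡false⁻ (x ∷ xs) e with p x in px
  ... | false = x , here refl , px
  ... | true  = let y , y∈ , py = allL≡false⁻ xs e in y , there y∈ , py

∈-subsets : (p : Subset n) → p ∈ₗ subsets n
∈-subsets []          = here refl
∈-subsets {suc n} (true ∷ p)  = ∈-++⁺ˡ (∈-map⁺ (true ∷_) (∈-subsets p))
∈-subsets {suc n} (false ∷ p) = ∈-++⁺ʳ (map (true ∷_) (subsets n)) (∈-map⁺ (false ∷_) (∈-subsets p))

∈-tabulate⁺ : {f : Fin n → Bool} {x : Fin n} → f x ≡ true → x ∈ tabulate f
∈-tabulate⁺ {f = f} {x} fx = lookup⇒[]= x (tabulate f) (trans (lookup∘tabulate f x) fx)

∈-tabulate⁻ : {f : Fin n → Bool} {x : Fin n} → x ∈ tabulate f → f x ≡ true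
∈-tabulate⁻ {f = f} {x} x∈ = trans (sym (lookup∘tabulate f x)) ([]=⇒lookup x∈)

∉-tabulate⁻ : {f : Fin n → Bool} {x : Fin n} → x ∉ tabulate f → f x ≡ false
∉-tabulate⁻ {f = f} {x} x∉ with f x in fx
... | true  = ⊥-elim (x∉ (∈-tabulate⁺ fx))
... | false = refl

lookup≡false⇒∉ : {p : Subset n} {x : Fin n} → lookup p x ≡ false → x ∉ p
lookup≡false⇒∉ px≡false x∈p = case trans (sym px≡false) ([]=⇒lookup x∈p) of λ ()

-- corona G and diadem G are, definitionally, unionOf (isMaxIndep? G) and unionOf (isCritIndep? G).
unionOf : (Subset n → Bool) → Subset n
unionOf {n} P = tabulate λ v → anyL (λ S → P S ∧ lookup S v) (subsets n)

∈-unionOf⁺ : ∀ (P : Subset n → Bool) {S v} → P S ≡ true → v ∈ S → v ∈ unionOf P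
∈-unionOf⁺ {n} P {S} {v} PS v∈S =
  ∈-tabulate⁺ (anyL⁺ _ (subsets n) (∈-subsets S) (∧≡true⁺ PS ([]=⇒lookup v∈S)))

∈-unionOf⁻ : ∀ (P : Subset n → Bool) {v} → v ∈ unionOf P → ∃ λ S → P S ≡ true × v ∈ S
∈-unionOf⁻ {n} P {v} v∈ with anyL⁻ _ (subsets n) (∈-tabulate⁻ v∈)
... | S , _ , e with ∧≡true⁻ (P S) e
... | PS , v∈S = S , PS , lookup⇒[]= v S v∈S

maxℕ-upper : ∀ xs {x} → x ∈ₗ xs → x ≤ maxℕ xs
maxℕ-upper (x ∷ xs) (here refl) = ℕ.m≤m⊔n x (maxℕ xs)
maxℕ-upper (y ∷ xs) (there x∈)  = ℕ.≤-trans (maxℕ-upper xs x∈) (ℕ.m≤n⊔m y (maxℕ xs))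

maxℤ-upper : ∀ xs {x} → x ∈ₗ xs → x ℤ.≤ maxℤ xs
maxℤ-upper (x ∷ xs) (here refl) = ℤ.i≤i⊔j x (maxℤ xs)
maxℤ-upper (y ∷ xs) (there x∈)  = ℤ.≤-trans (maxℤ-upper xs x∈) (ℤ.i≤j⊔i y (maxℤ xs))

maxℤ-lub : ∀ xs {c} → ℤ.0ℤ ℤ.≤ c → All (ℤ._≤ c) xs → maxℤ xs ℤ.≤ c
maxℤ-lub xs 0≤c xs≤c = List.foldr-preservesᵇ ℤ.⊔-lub 0≤c xs≤c

ℤ+-cancelʳ-≤ : ∀ k {x y} → x ℤ.+ k ℤ.≤ y ℤ.+ k → x ℤ.≤ y
ℤ+-cancelʳ-≤ k {x} {y} le = subst₂ ℤ._≤_ (unshift x) (unshift y) (ℤ.+-monoˡ-≤ (ℤ.- k) le)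
  where
  open +-*-Solver
  unshift : ∀ x → x ℤ.+ k ℤ.+ ℤ.- k ≡ x
  unshift x = solve 2 (λ x k → x :+ k :+ :- k := x) refl x k

-≤-⇔+≤+ : ∀ a b c e → (ℤ.+ a ℤ.- ℤ.+ b ℤ.≤ ℤ.+ c ℤ.- ℤ.+ e) ⇔ (a + e ≤ c + b)
-≤-⇔+≤+ a b c e = mk⇔
  (λ le → ℤ.drop‿+≤+ (subst₂ ℤ._≤_ lhs rhs (ℤ.+-monoˡ-≤ k le)))
  (λ le → ℤ+-cancelʳ-≤ k (subst₂ ℤ._≤_ (sym lhs) (sym rhs) (ℤ.+≤+ le)))
  where
  open +-*-Solver
  k : ℤ
  k = ℤ.+ b ℤ.+ ℤ.+ e
  lhs : (ℤ.+ a ℤ.- ℤ.+ b) ℤ.+ k ≡ ℤ.+ (a + e)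
  lhs rewrite ℤ.pos-+ a e = solve 3 (λ a b e → (a :- b) :+ (b :+ e) := a :+ e) refl (ℤ.+ a) (ℤ.+ b) (ℤ.+ e)
  rhs : (ℤ.+ c ℤ.- ℤ.+ e) ℤ.+ k ≡ ℤ.+ (c + b)
  rhs rewrite ℤ.pos-+ c b = solve 3 (λ b c e → (c :- e) :+ (b :+ e) := c :+ b) refl (ℤ.+ b) (ℤ.+ c) (ℤ.+ e)

-≡-⇔+≡+ : ∀ a b c e → (ℤ.+ a ℤ.- ℤ.+ b ≡ ℤ.+ c ℤ.- ℤ.+ e) ⇔ (a + e ≡ c + b)
-≡-⇔+≡+ a b c e = mk⇔
  (λ eq → ℕ.≤-antisym (to (ℤ.≤-reflexive eq)) (Equivalence.to (-≤-⇔+≤+ c e a b) (ℤ.≤-reflexive (sym eq))))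
  (λ eq → ℤ.≤-antisym (from (ℕ.≤-reflexive eq)) (Equivalence.from (-≤-⇔+≤+ c e a b) (ℕ.≤-reflexive (sym eq))))
  where open Equivalence (-≤-⇔+≤+ a b c e)

[a]-[m∸b]≡[a+b]-[m] : ∀ a {b m} → b ≤ m → ℤ.+ a ℤ.- ℤ.+ (m ∸ b) ≡ ℤ.+ (a + b) ℤ.- ℤ.+ m
[a]-[m∸b]≡[a+b]-[m] a {b} {m} b≤m = Equivalence.from (-≡-⇔+≡+ a (m ∸ b) (a + b) m) (begin
  a + m               ≡⟨ cong (a +_) (sym (ℕ.m+[n∸m]≡n b≤m)) ⟩
  a + (b + (m ∸ b))   ≡⟨ sym (ℕ.+-assoc a b (m ∸ b)) ⟩
  a + b + (m ∸ b)     ∎)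
  where open ≡-Reasoning

[a-b]+[c-e]≡[a+c]-[b+e] : ∀ a b c e →
  (ℤ.+ a ℤ.- ℤ.+ b) ℤ.+ (ℤ.+ c ℤ.- ℤ.+ e) ≡ ℤ.+ (a + c) ℤ.- ℤ.+ (b + e)
[a-b]+[c-e]≡[a+c]-[b+e] a b c e rewrite ℤ.pos-+ a c | ℤ.pos-+ b e =
  solve 4 (λ a b c e → (a :- b) :+ (c :- e) := (a :+ c) :- (b :+ e)) refl (ℤ.+ a) (ℤ.+ b) (ℤ.+ c) (ℤ.+ e)
  where open +-*-Solver

endpoints : List (Fin n × Fin n) → List (Fin n)
endpoints = concatMap λ e → proj₁ e ∷ proj₂ e ∷ []

length-endpoints : ∀ (M : List (Fin n × Fin n)) → length (endpoints M) ≡ length M + length M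
length-endpoints []      = refl
length-endpoints (_ ∷ M) = cong suc (trans (cong suc (length-endpoints M)) (sym (ℕ.+-suc (length M) (length M))))

partner : List (Fin n × Fin n) → Fin n → Fin n
partner []            x = x
partner ((u , v) ∷ M) x with x Fin.≟ u | x Fin.≟ v
... | yes _ | _     = v
... | no _  | yes _ = u
... | no _  | no _  = partner M x

module _ {n : ℕ} (M : List (Fin n × Fin n)) (u v : Fin n) where

  partner-∷-left : partner ((u , v) ∷ M) u ≡ v
  partner-∷-left with u Fin.≟ u
  ... | yes _ = refl
  ... | no u≢u = ⊥-elim (u≢u refl)

  partner-∷-right : u ≢ v → partner ((u , v) ∷ M) v ≡ u
  partner-∷-right u≢v with v Fin.≟ u | v Fin.≟ v
  ... | yes v≡u | _     = ⊥-elim (u≢v (sym v≡u))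
  ... | no _    | yes _ = refl
  ... | no _    | no v≢v = ⊥-elim (v≢v refl)

  partner-∷-other : ∀ {x} → x ≢ u → x ≢ v → partner ((u , v) ∷ M) x ≡ partner M x
  partner-∷-other {x} x≢u x≢v with x Fin.≟ u | x Fin.≟ v
  ... | yes x≡u | _       = ⊥-elim (x≢u x≡u)
  ... | no _    | yes x≡v = ⊥-elim (x≢v x≡v)
  ... | no _    | no _    = refl

module _ {n : ℕ} (G : Graph n) where

  -- Neighbourhoods, independence and the surplus d

  Adj : Fin n → Fin n → Set
  Adj u v = adj G u v ≡ true

  Adj-sym : ∀ {u v} → Adj u v → Adj v u
  Adj-sym {u} {v} = trans (adj-sym G v u)

  Adj-irrefl : ∀ {u} → ¬ Adj u u
  Adj-irrefl {u} uu with trans (sym uu) (adj-irrefl G u)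
  ... | ()

  ∈N⁺ : ∀ {X u v} → u ∈ X → Adj u v → v ∈ N G X
  ∈N⁺ {X} {u} u∈X uv = ∈-tabulate⁺ (anyFin⁺ _ u (∧≡true⁺ ([]=⇒lookup u∈X) uv))

  ∈N⁻ : ∀ {X v} → v ∈ N G X → ∃ λ u → u ∈ X × Adj u v
  ∈N⁻ {X} v∈NX with anyFin⁻ _ (∈-tabulate⁻ v∈NX)
  ... | u , e with ∧≡true⁻ (lookup X u) e
  ... | u∈X , uv = u , lookup⇒[]= u X u∈X , uv

  N-mono : ∀ {X Y} → X ⊆ Y → N G X ⊆ N G Y
  N-mono X⊆Y v∈ with ∈N⁻ v∈
  ... | u , u∈X , uv = ∈N⁺ (X⊆Y u∈X) uv

  N-∪ : ∀ X Y → N G (X ∪ Y) ⊆ N G X ∪ N G Y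
  N-∪ X Y v∈ with ∈N⁻ v∈
  ... | u , u∈X∪Y , uv with x∈p∪q⁻ X Y u∈X∪Y
  ... | inj₁ u∈X = x∈p∪q⁺ (inj₁ (∈N⁺ u∈X uv))
  ... | inj₂ u∈Y = x∈p∪q⁺ (inj₂ (∈N⁺ u∈Y uv))

  N-∩ : ∀ X Y → N G (X ∩ Y) ⊆ N G X ∩ N G Y
  N-∩ X Y v∈ = x∈p∩q⁺ (N-mono (p∩q⊆p X Y) v∈ , N-mono (p∩q⊆q X Y) v∈)

  record Independent (S : Subset n) : Set where
    constructor independent
    field nonadjacent : ∀ {u v} → u ∈ S → v ∈ S → ¬ Adj u v
  open Independent public

  independent?⁻ : ∀ {S} → independent? G S ≡ true → Independent S
  independent?⁻ {S} e = independent λ {u} {v} u∈S v∈S →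
    nand⁻ (allFin⁻ _ (allFin⁻ _ e u) v) ([]=⇒lookup u∈S) ([]=⇒lookup v∈S)
    where
    nand⁻ : ∀ {a b c} → not (a ∧ b ∧ c) ≡ true → a ≡ true → b ≡ true → ¬ c ≡ true
    nand⁻ () refl refl refl

  independent?⁺ : ∀ {S} → Independent S → independent? G S ≡ true
  independent?⁺ {S} I = allFin⁺ _ λ u → allFin⁺ _ λ v →
    nand⁺ (λ u∈S v∈S → nonadjacent I (lookup⇒[]= u S u∈S) (lookup⇒[]= v S v∈S))
    where
    nand⁺ : ∀ {a b c} → (a ≡ true → b ≡ true → ¬ c ≡ true) → not (a ∧ b ∧ c) ≡ true
    nand⁺ {true}  {true}  {true}  h = ⊥-elim (h refl refl refl)
    nand⁺ {true}  {true}  {false} h = refl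
    nand⁺ {true}  {false}         h = refl
    nand⁺ {false}                 h = refl

  Independent-⊆ : ∀ {S T} → T ⊆ S → Independent S → Independent T
  Independent-⊆ T⊆S I = independent λ u∈ v∈ → nonadjacent I (T⊆S u∈) (T⊆S v∈)

  Independent-⊥ : Independent ⊥
  Independent-⊥ = independent λ u∈⊥ _ _ → ∉⊥ u∈⊥

  N-Independent : ∀ {S} → Independent S → N G S ⊆ ∁ S
  N-Independent I v∈NS with ∈N⁻ v∈NS
  ... | u , u∈S , uv = x∉p⇒x∈∁p λ v∈S → nonadjacent I u∈S v∈S uv

  d-supermodular : ∀ X Y → d G X ℤ.+ d G Y ℤ.≤ d G (X ∪ Y) ℤ.+ d G (X ∩ Y)
  d-supermodular X Y = subst₂ ℤ._≤_ (sym (split X Y)) (sym (split (X ∪ Y) (X ∩ Y)))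
    (Equivalence.from (-≤-⇔+≤+ (∣ X ∣ + ∣ Y ∣) (∣ N G X ∣ + ∣ N G Y ∣)
                               (∣ X ∪ Y ∣ + ∣ X ∩ Y ∣) (∣ N G (X ∪ Y) ∣ + ∣ N G (X ∩ Y) ∣)) counting)
    where
    open ℕ.≤-Reasoning
    split : ∀ A B → d G A ℤ.+ d G B ≡ ℤ.+ (∣ A ∣ + ∣ B ∣) ℤ.- ℤ.+ (∣ N G A ∣ + ∣ N G B ∣)
    split A B = [a-b]+[c-e]≡[a+c]-[b+e] (∣ A ∣) (∣ N G A ∣) (∣ B ∣) (∣ N G B ∣)
    N-submodular : ∣ N G (X ∪ Y) ∣ + ∣ N G (X ∩ Y) ∣ ≤ ∣ N G X ∣ + ∣ N G Y ∣
    N-submodular = ℕ.≤-trans (ℕ.+-mono-≤ (p⊆q⇒∣p∣≤∣q∣ (N-∪ X Y)) (p⊆q⇒∣p∣≤∣q∣ (N-∩ X Y)))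
                             (ℕ.≤-reflexive (∣p∪q∣+∣p∩q∣≡∣p∣+∣q∣ (N G X) (N G Y)))
    counting : ∣ X ∣ + ∣ Y ∣ + (∣ N G (X ∪ Y) ∣ + ∣ N G (X ∩ Y) ∣)
             ≤ ∣ X ∪ Y ∣ + ∣ X ∩ Y ∣ + (∣ N G X ∣ + ∣ N G Y ∣)
    counting = begin
      ∣ X ∣ + ∣ Y ∣ + (∣ N G (X ∪ Y) ∣ + ∣ N G (X ∩ Y) ∣)
        ≤⟨ ℕ.+-monoʳ-≤ (∣ X ∣ + ∣ Y ∣) N-submodular ⟩
      ∣ X ∣ + ∣ Y ∣ + (∣ N G X ∣ + ∣ N G Y ∣)
        ≡⟨ cong (_+ (∣ N G X ∣ + ∣ N G Y ∣)) (sym (∣p∪q∣+∣p∩q∣≡∣p∣+∣q∣ X Y)) ⟩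
      ∣ X ∪ Y ∣ + ∣ X ∩ Y ∣ + (∣ N G X ∣ + ∣ N G Y ∣)
        ∎

  d-∪-≥ : ∀ {m} X Y → m ℤ.≤ d G X → m ℤ.≤ d G Y → d G (X ∩ Y) ℤ.≤ m → m ℤ.≤ d G (X ∪ Y)
  d-∪-≥ {m} X Y m≤X m≤Y X∩Y≤m = ℤ+-cancelʳ-≤ m (begin
    m ℤ.+ m                           ≤⟨ ℤ.+-mono-≤ m≤X m≤Y ⟩
    d G X ℤ.+ d G Y                   ≤⟨ d-supermodular X Y ⟩
    d G (X ∪ Y) ℤ.+ d G (X ∩ Y)       ≤⟨ ℤ.+-monoʳ-≤ (d G (X ∪ Y)) X∩Y≤m ⟩
    d G (X ∪ Y) ℤ.+ m                 ∎)
    where open ℤ.≤-Reasoning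

  d-unionOf-≥ : ∀ {m} (P : Subset n → Bool) B → P B ≡ true →
    (∀ {S} → P S ≡ true → m ℤ.≤ d G S) → (∀ {S} X → P S ≡ true → d G (S ∩ X) ℤ.≤ m) →
    m ℤ.≤ d G (unionOf P)
  d-unionOf-≥ {m} P B PB m≤S S∩X≤m = subst (λ U → m ℤ.≤ d G U) unionFrom-subsets (m≤unionFrom (subsets n))
    where
    unionFrom : List (Subset n) → Subset n
    unionFrom []       = B
    unionFrom (S ∷ Ss) = if P S then S ∪ unionFrom Ss else unionFrom Ss

    m≤unionFrom : ∀ Ss → m ℤ.≤ d G (unionFrom Ss)
    m≤unionFrom []       = m≤S PB
    m≤unionFrom (S ∷ Ss) with P S in PS
    ... | true  = d-∪-≥ S (unionFrom Ss) (m≤S PS) (m≤unionFrom Ss) (S∩X≤m (unionFrom Ss) PS)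
    ... | false = m≤unionFrom Ss

    ⊆unionFrom : ∀ {Ss S v} → S ∈ₗ Ss → P S ≡ true → v ∈ S → v ∈ unionFrom Ss
    ⊆unionFrom {S ∷ Ss} (here refl) PS v∈S rewrite PS = p⊆p∪q (unionFrom Ss) v∈S
    ⊆unionFrom {T ∷ Ss} (there S∈) PS v∈S with P T
    ... | true  = q⊆p∪q T (unionFrom Ss) (⊆unionFrom S∈ PS v∈S)
    ... | false = ⊆unionFrom S∈ PS v∈S

    unionFrom⊆ : ∀ Ss {v} → v ∈ unionFrom Ss → v ∈ unionOf P
    unionFrom⊆ []       v∈ = ∈-unionOf⁺ P PB v∈
    unionFrom⊆ (S ∷ Ss) v∈ with P S in PS
    ... | false = unionFrom⊆ Ss v∈
    ... | true with x∈p∪q⁻ S (unionFrom Ss) v∈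
    ...   | inj₁ v∈S = ∈-unionOf⁺ P PS v∈S
    ...   | inj₂ v∈U = unionFrom⊆ Ss v∈U

    unionFrom-subsets : unionFrom (subsets n) ≡ unionOf P
    unionFrom-subsets = ⊆-antisym (unionFrom⊆ (subsets n)) λ v∈ →
      let S , PS , v∈S = ∈-unionOf⁻ P v∈ in ⊆unionFrom (∈-subsets S) PS v∈S

  ∈-indepSets⁺ : ∀ {S} → Independent S → S ∈ₗ indepSets G
  ∈-indepSets⁺ {S} I = ∈-filter⁺ (T? ∘ independent? G) (∈-subsets S) (Equivalence.from T-≡ (independent?⁺ I))

  ∈-indepSets⁻ : ∀ {S} → S ∈ₗ indepSets G → Independent S
  ∈-indepSets⁻ S∈ = independent?⁻ (Equivalence.to T-≡ (proj₂ (∈-filter⁻ (T? ∘ independent? G) {xs = subsets n} S∈)))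

  α-upper : ∀ {S} → Independent S → ∣ S ∣ ≤ α G
  α-upper {S} I = maxℕ-upper (map ∣_∣ (indepSets G)) (∈-map⁺ ∣_∣ (∈-indepSets⁺ I))

  MaximumIndependent : Subset n → Set
  MaximumIndependent S = Independent S × ∣ S ∣ ≡ α G

  maximumIndependent : ∃ MaximumIndependent
  maximumIndependent with foldr-selective ℕ.⊔-sel 0 (map ∣_∣ (indepSets G))
  ... | inj₁ α≡0 = ⊥ , Independent-⊥ , trans (∣⊥∣≡0 n) (sym α≡0)
  ... | inj₂ α∈ with ∈-map⁻ ∣_∣ α∈
  ...   | S , S∈ , α≡∣S∣ = S , ∈-indepSets⁻ S∈ , sym α≡∣S∣

  isMaxIndep?⁺ : ∀ {S} → MaximumIndependent S → isMaxIndep? G S ≡ true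
  isMaxIndep?⁺ {S} (I , ∣S∣≡α) = ∧≡true⁺ (independent?⁺ I) (Equivalence.to T-≡ (ℕ.≡⇒≡ᵇ ∣ S ∣ (α G) ∣S∣≡α))

  isMaxIndep?⁻ : ∀ {S} → isMaxIndep? G S ≡ true → MaximumIndependent S
  isMaxIndep?⁻ {S} e with ∧≡true⁻ (independent? G S) e
  ... | I , ∣S∣≡ᵇα = independent?⁻ I , ℕ.≡ᵇ⇒≡ ∣ S ∣ (α G) (Equivalence.from T-≡ ∣S∣≡ᵇα)

  core⁻ : ∀ {v S} → v ∈ core G → MaximumIndependent S → v ∈ S
  core⁻ {v} {S} v∈ M with ∨≡true⁻ (not (isMaxIndep? G S)) (allL⁻ _ (subsets n) (∈-tabulate⁻ v∈) (∈-subsets S))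
  ... | inj₁ notMax rewrite isMaxIndep?⁺ M = case notMax of λ ()
  ... | inj₂ v∈S = lookup⇒[]= v S v∈S

  ∉core⁻ : ∀ {v} → v ∉ core G → ∃ λ S → MaximumIndependent S × v ∉ S
  ∉core⁻ {v} v∉ with allL≡false⁻ _ (subsets n) (∉-tabulate⁻ v∉)
  ... | S , _ , e = S , isMaxIndep?⁻ (not-injective (∨-conicalˡ _ _ e)) , lookup≡false⇒∉ (∨-conicalʳ _ _ e)

  corona⁺ : ∀ {v S} → MaximumIndependent S → v ∈ S → v ∈ corona G
  corona⁺ M = ∈-unionOf⁺ (isMaxIndep? G) (isMaxIndep?⁺ M)

  corona⁻ : ∀ {v} → v ∈ corona G → ∃ λ S → MaximumIndependent S × v ∈ S
  corona⁻ v∈ = let S , max , v∈S = ∈-unionOf⁻ (isMaxIndep? G) v∈ in S , isMaxIndep?⁻ max , v∈S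

  d-⊥ : d G ⊥ ≡ ℤ.0ℤ
  d-⊥ rewrite ∣⊥∣≡0 n | Empty⇒∣p∣≡0 {p = N G ⊥} (λ (v , v∈) → ∉⊥ (proj₁ (proj₂ (∈N⁻ v∈)))) = refl

  dG-upper : ∀ X → d G X ℤ.≤ dG G
  dG-upper X = maxℤ-upper (map (d G) (subsets n)) (∈-map⁺ (d G) (∈-subsets X))

  dG-lub : ∀ {c} → (∀ X → d G X ℤ.≤ c) → dG G ℤ.≤ c
  dG-lub {c} X≤c = maxℤ-lub (map (d G) (subsets n)) (subst (ℤ._≤ c) d-⊥ (X≤c ⊥))
                            (Allₚ.map⁺ (All.tabulate λ {X} _ → X≤c X))

  dIndep-upper : ∀ {X} → Independent X → d G X ℤ.≤ dIndep G
  dIndep-upper I = maxℤ-upper (map (d G) (indepSets G)) (∈-map⁺ (d G) (∈-indepSets⁺ I))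

  dIndep≤dG : dIndep G ℤ.≤ dG G
  dIndep≤dG = maxℤ-lub (map (d G) (indepSets G)) (subst (ℤ._≤ dG G) d-⊥ (dG-upper ⊥))
                       (Allₚ.map⁺ (All.tabulate λ {X} _ → dG-upper X))

  CriticalIndependent : Subset n → Set
  CriticalIndependent A = Independent A × d G A ≡ dIndep G

  criticalIndependent : ∃ CriticalIndependent
  criticalIndependent with foldr-selective ℤ.⊔-sel ℤ.0ℤ (map (d G) (indepSets G))
  ... | inj₁ dIndep≡0 = ⊥ , Independent-⊥ , trans d-⊥ (sym dIndep≡0)
  ... | inj₂ dIndep∈ with ∈-map⁻ (d G) dIndep∈
  ...   | A , A∈ , dIndep≡dA = A , ∈-indepSets⁻ A∈ , sym dIndep≡dA

  isCritIndep?⁺ : ∀ {A} → CriticalIndependent A → isCritIndep? G A ≡ true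
  isCritIndep?⁺ {A} (I , dA≡) with d G A ℤ.≟ dIndep G
  ... | yes _   = ∧≡true⁺ (independent?⁺ I) refl
  ... | no dA≢ = ⊥-elim (dA≢ dA≡)

  isCritIndep?⁻ : ∀ {A} → isCritIndep? G A ≡ true → CriticalIndependent A
  isCritIndep?⁻ {A} e with d G A ℤ.≟ dIndep G | ∧≡true⁻ (independent? G A) e
  ... | yes dA≡ | I , _ = independent?⁻ I , dA≡

  diadem⁻ : ∀ {v} → v ∈ diadem G → ∃ λ A → CriticalIndependent A × v ∈ A
  diadem⁻ v∈ = let A , crit , v∈A = ∈-unionOf⁻ (isCritIndep? G) v∈ in A , isCritIndep?⁻ crit , v∈A

  diadem⁺ : ∀ {v A} → CriticalIndependent A → v ∈ A → v ∈ diadem G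
  diadem⁺ C = ∈-unionOf⁺ (isCritIndep? G) (isCritIndep?⁺ C)

  Independent-∪ : ∀ {S T} → Independent S → Independent T → (∀ {v} → v ∈ T → v ∉ N G S) → Independent (S ∪ T)
  Independent-∪ {S} {T} IS IT T∩NS=∅ = independent λ {u} {v} u∈ v∈ uv →
    case x∈p∪q⁻ S T u∈ , x∈p∪q⁻ S T v∈ of λ where
      (inj₁ u∈S , inj₁ v∈S) → nonadjacent IS u∈S v∈S uv
      (inj₂ u∈T , inj₂ v∈T) → nonadjacent IT u∈T v∈T uv
      (inj₁ u∈S , inj₂ v∈T) → T∩NS=∅ v∈T (∈N⁺ u∈S uv)
      (inj₂ u∈T , inj₁ v∈S) → T∩NS=∅ u∈T (∈N⁺ v∈S (Adj-sym uv))

  Independent-⁅⁆ : ∀ v → Independent ⁅ v ⁆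
  Independent-⁅⁆ v = independent λ u∈ w∈ uw →
    Adj-irrefl (subst₂ Adj (x∈⁅y⁆⇒x≡y v u∈) (x∈⁅y⁆⇒x≡y v w∈) uw)

  ∉maximum⇒∈N : ∀ {S v} → MaximumIndependent S → v ∉ S → v ∈ N G S
  ∉maximum⇒∈N {S} {v} (I , ∣S∣≡α) v∉S with v ∈? N G S
  ... | yes v∈NS = v∈NS
  ... | no v∉NS = ⊥-elim (ℕ.<⇒≱ α<∣S∪⁅v⁆∣ (α-upper (Independent-∪ I (Independent-⁅⁆ v) ⁅v⁆∌NS)))
    where
    ⁅v⁆∌NS : ∀ {w} → w ∈ ⁅ v ⁆ → w ∉ N G S
    ⁅v⁆∌NS w∈ = v∉NS ∘ subst (_∈ N G S) (x∈⁅y⁆⇒x≡y v w∈)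
    α<∣S∪⁅v⁆∣ : α G < ∣ S ∪ ⁅ v ⁆ ∣
    α<∣S∪⁅v⁆∣ = ℕ.≤-reflexive (begin
      suc (α G)           ≡⟨ ℕ.+-comm 1 (α G) ⟩
      α G + 1             ≡⟨ cong₂ _+_ (sym ∣S∣≡α) (sym (∣⁅x⁆∣≡1 v)) ⟩
      ∣ S ∣ + ∣ ⁅ v ⁆ ∣   ≡⟨ sym (Disjoint⇒∣p∪q∣≡∣p∣+∣q∣ S ⁅ v ⁆ disjoint) ⟩
      ∣ S ∪ ⁅ v ⁆ ∣       ∎)
      where
      open ≡-Reasoning
      disjoint : Empty (S ∩ ⁅ v ⁆)
      disjoint (w , w∈) = let w∈S , w∈⁅v⁆ = x∈p∩q⁻ S ⁅ v ⁆ w∈ in v∉S (subst (_∈ S) (x∈⁅y⁆⇒x≡y v w∈⁅v⁆) w∈S)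

  N-corona≡∁core : N G (corona G) ≡ ∁ (core G)
  N-corona≡∁core = ⊆-antisym N-corona⊆ ∁core⊆
    where
    N-corona⊆ : N G (corona G) ⊆ ∁ (core G)
    N-corona⊆ v∈ with ∈N⁻ v∈
    ... | u , u∈ , uv with corona⁻ u∈
    ...   | S , M , u∈S = x∉p⇒x∈∁p λ v∈core → nonadjacent (proj₁ M) u∈S (core⁻ v∈core M) uv
    ∁core⊆ : ∁ (core G) ⊆ N G (corona G)
    ∁core⊆ v∈ with ∉core⁻ (x∈∁p⇒x∉p v∈)
    ... | S , M , v∉S with ∈N⁻ (∉maximum⇒∈N M v∉S)
    ...   | u , u∈S , uv = ∈N⁺ (corona⁺ M u∈S) uv

  -- Hall's theorem

  HallCondition : Subset n → Subset n → Set
  HallCondition T R = ∀ Y → Y ⊆ T → ∣ Y ∣ ≤ ∣ R ∩ N G Y ∣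

  Saturating : Subset n → Subset n → Set
  Saturating T R = ∃ λ (f : Fin n → Fin n) → (∀ {t} → t ∈ T → f t ∈ R × Adj t (f t)) × InjectiveOn T f

  Saturating-mono : ∀ {T T′ R R′} → T′ ⊆ T → R ⊆ R′ → Saturating T R → Saturating T′ R′
  Saturating-mono T′⊆T R⊆R′ (f , f∈R , f-inj) =
    f , (λ t∈ → let ft∈R , tft = f∈R (T′⊆T t∈) in R⊆R′ ft∈R , tft) , λ t∈ t′∈ → f-inj (T′⊆T t∈) (T′⊆T t′∈)

  Saturating-N : ∀ {T R} → Saturating T R → Saturating T (R ∩ N G T)
  Saturating-N (f , f∈R , f-inj) = f , (λ t∈ → let ft∈R , tft = f∈R t∈ in x∈p∩q⁺ (ft∈R , ∈N⁺ t∈ tft) , tft) , f-inj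

  Saturating-∪ : ∀ {T₁ T₂ R₁ R₂} → Empty (R₁ ∩ R₂) →
    Saturating T₁ R₁ → Saturating T₂ R₂ → Saturating (T₁ ∪ T₂) (R₁ ∪ R₂)
  Saturating-∪ {T₁} {T₂} {R₁} {R₂} R₁∩R₂=∅ (f₁ , f₁∈ , f₁-inj) (f₂ , f₂∈ , f₂-inj) = f , f∈ , f-inj
    where
    f : Fin n → Fin n
    f t with t ∈? T₁
    ... | yes _ = f₁ t
    ... | no  _ = f₂ t
    inT₂ : ∀ {t} → t ∈ T₁ ∪ T₂ → t ∉ T₁ → t ∈ T₂
    inT₂ {t} t∈ t∉T₁ with x∈p∪q⁻ T₁ T₂ t∈
    ... | inj₁ t∈T₁ = ⊥-elim (t∉T₁ t∈T₁)
    ... | inj₂ t∈T₂ = t∈T₂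
    f∈ : ∀ {t} → t ∈ T₁ ∪ T₂ → f t ∈ R₁ ∪ R₂ × Adj t (f t)
    f∈ {t} t∈ with t ∈? T₁
    ... | yes t∈T₁ = let r , a = f₁∈ t∈T₁ in x∈p∪q⁺ (inj₁ r) , a
    ... | no t∉T₁  = let r , a = f₂∈ (inT₂ t∈ t∉T₁) in x∈p∪q⁺ (inj₂ r) , a
    clash : ∀ {t t′} → t ∈ T₁ → t′ ∈ T₂ → f₁ t ≢ f₂ t′
    clash t∈ t′∈ eq = R₁∩R₂=∅ (f₁ _ , x∈p∩q⁺ (proj₁ (f₁∈ t∈) , subst (_∈ R₂) (sym eq) (proj₁ (f₂∈ t′∈))))
    f-inj : InjectiveOn (T₁ ∪ T₂) f
    f-inj {t} {t′} t∈ t′∈ eq with t ∈? T₁ | t′ ∈? T₁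
    ... | yes t∈T₁ | yes t′∈T₁ = f₁-inj t∈T₁ t′∈T₁ eq
    ... | no t∉T₁  | no t′∉T₁  = f₂-inj (inT₂ t∈ t∉T₁) (inT₂ t′∈ t′∉T₁) eq
    ... | yes t∈T₁ | no t′∉T₁  = ⊥-elim (clash t∈T₁ (inT₂ t′∈ t′∉T₁) eq)
    ... | no t∉T₁  | yes t′∈T₁ = ⊥-elim (clash t′∈T₁ (inT₂ t∈ t∉T₁) (sym eq))

  Tight : Subset n → Subset n → Subset n → Set
  Tight T R Y = Y ⊆ T × 0 < ∣ Y ∣ × ∣ Y ∣ < ∣ T ∣ × ∣ R ∩ N G Y ∣ ≤ ∣ Y ∣

  tight? : ∀ T R Y → Dec (Tight T R Y)
  tight? T R Y = Y ⊆? T ×-dec 0 ℕ.<? ∣ Y ∣ ×-dec ∣ Y ∣ ℕ.<? ∣ T ∣ ×-dec ∣ R ∩ N G Y ∣ ℕ.≤? ∣ Y ∣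

  HallCondition-tight : ∀ T R {Y} → Tight T R Y → HallCondition T R → HallCondition (T ∩ ∁ Y) (R ∩ ∁ (N G Y))
  HallCondition-tight T R {Y} (Y⊆T , _ , _ , tight) hall Z Z⊆ = ℕ.+-cancelʳ-≤ (∣ Y ∣) (∣ Z ∣) _ (begin
    ∣ Z ∣ + ∣ Y ∣                                  ≡⟨ sym (Disjoint⇒∣p∪q∣≡∣p∣+∣q∣ Z Y Z∩Y=∅) ⟩
    ∣ Z ∪ Y ∣                                      ≤⟨ hall (Z ∪ Y) Z∪Y⊆T ⟩
    ∣ R ∩ N G (Z ∪ Y) ∣                            ≤⟨ p⊆q⇒∣p∣≤∣q∣ split ⟩
    ∣ (R ∩ ∁ (N G Y)) ∩ N G Z ∪ R ∩ N G Y ∣        ≤⟨ ∣p∪q∣≤∣p∣+∣q∣ ((R ∩ ∁ (N G Y)) ∩ N G Z) (R ∩ N G Y) ⟩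
    ∣ (R ∩ ∁ (N G Y)) ∩ N G Z ∣ + ∣ R ∩ N G Y ∣    ≤⟨ ℕ.+-monoʳ-≤ _ tight ⟩
    ∣ (R ∩ ∁ (N G Y)) ∩ N G Z ∣ + ∣ Y ∣            ∎)
    where
    open ℕ.≤-Reasoning
    Z∩Y=∅ : Empty (Z ∩ Y)
    Z∩Y=∅ (v , v∈) = let v∈Z , v∈Y = x∈p∩q⁻ Z Y v∈ in x∈∁p⇒x∉p (proj₂ (x∈p∩q⁻ T (∁ Y) (Z⊆ v∈Z))) v∈Y
    Z∪Y⊆T : Z ∪ Y ⊆ T
    Z∪Y⊆T v∈ with x∈p∪q⁻ Z Y v∈
    ... | inj₁ v∈Z = p∩q⊆p T (∁ Y) (Z⊆ v∈Z)
    ... | inj₂ v∈Y = Y⊆T v∈Y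
    split : R ∩ N G (Z ∪ Y) ⊆ (R ∩ ∁ (N G Y)) ∩ N G Z ∪ R ∩ N G Y
    split {v} v∈ with x∈p∩q⁻ R (N G (Z ∪ Y)) v∈ | v ∈? N G Y
    ... | v∈R , _       | yes v∈NY = x∈p∪q⁺ (inj₂ (x∈p∩q⁺ (v∈R , v∈NY)))
    ... | v∈R , v∈NZ∪Y  | no v∉NY with x∈p∪q⁻ (N G Z) (N G Y) (N-∪ Z Y v∈NZ∪Y)
    ...   | inj₁ v∈NZ = x∈p∪q⁺ (inj₁ (x∈p∩q⁺ (x∈p∩q⁺ (v∈R , x∉p⇒x∈∁p v∉NY) , v∈NZ)))
    ...   | inj₂ v∈NY = ⊥-elim (v∉NY v∈NY)

  HallCondition-loose : ∀ T R {t} r → (∀ Y → ¬ Tight T R Y) → t ∈ T →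
    HallCondition T R → HallCondition (T ∩ ∁ ⁅ t ⁆) (R ∩ ∁ ⁅ r ⁆)
  HallCondition-loose T R {t} r loose t∈T hall Z Z⊆ with ∣ Z ∣ ℕ.≟ 0
  ... | yes ∣Z∣≡0 = ℕ.≤-trans (ℕ.≤-reflexive ∣Z∣≡0) z≤n
  ... | no ∣Z∣≢0 = ℕ.≤-pred (begin
    suc ∣ Z ∣                            ≤⟨ ∣Z∣<∣R∩NZ∣ ⟩
    ∣ R ∩ N G Z ∣                        ≤⟨ ∣p∣≤1+∣p∩∁⁅x⁆∣ r (R ∩ N G Z) ⟩
    suc ∣ (R ∩ N G Z) ∩ ∁ ⁅ r ⁆ ∣        ≤⟨ s≤s (p⊆q⇒∣p∣≤∣q∣ reorder) ⟩
    suc ∣ (R ∩ ∁ ⁅ r ⁆) ∩ N G Z ∣        ∎)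
    where
    open ℕ.≤-Reasoning
    Z⊆T : Z ⊆ T
    Z⊆T = p∩q⊆p T (∁ ⁅ t ⁆) ∘ Z⊆
    ∣Z∣<∣R∩NZ∣ : ∣ Z ∣ < ∣ R ∩ N G Z ∣
    ∣Z∣<∣R∩NZ∣ with suc ∣ Z ∣ ℕ.≤? ∣ R ∩ N G Z ∣
    ... | yes lt = lt
    ... | no ≮ = ⊥-elim (loose Z (Z⊆T , ℕ.n≢0⇒n>0 ∣Z∣≢0 ,
                   ℕ.<-≤-trans (s≤s (p⊆q⇒∣p∣≤∣q∣ Z⊆)) (x∈p⇒∣p∩∁⁅x⁆∣<∣p∣ t∈T) , ℕ.≤-pred (ℕ.≰⇒> ≮)))
    reorder : (R ∩ N G Z) ∩ ∁ ⁅ r ⁆ ⊆ (R ∩ ∁ ⁅ r ⁆) ∩ N G Z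
    reorder v∈ = let v∈R∩NZ , v∉r = x∈p∩q⁻ _ _ v∈ ; v∈R , v∈NZ = x∈p∩q⁻ R _ v∈R∩NZ
                 in x∈p∩q⁺ (x∈p∩q⁺ (v∈R , v∉r) , v∈NZ)

  Saturating-∅ : ∀ {T R} → Empty T → Saturating T R
  Saturating-∅ T=∅ = (λ t → t) , (λ t∈ → ⊥-elim (T=∅ (_ , t∈))) , λ t∈ → ⊥-elim (T=∅ (_ , t∈))

  Saturating-⁅⁆ : ∀ {t r} → Adj t r → Saturating ⁅ t ⁆ ⁅ r ⁆
  Saturating-⁅⁆ {t} {r} tr = (λ _ → r)
    , (λ t′∈ → x∈⁅x⁆ r , subst (λ u → Adj u r) (sym (x∈⁅y⁆⇒x≡y t t′∈)) tr)
    , λ t₁∈ t₂∈ _ → trans (x∈⁅y⁆⇒x≡y t t₁∈) (sym (x∈⁅y⁆⇒x≡y t t₂∈))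

  Saturating-split : ∀ {T R} Y → Saturating Y R → Saturating (T ∩ ∁ Y) (R ∩ ∁ (N G Y)) → Saturating T R
  Saturating-split {T} {R} Y satY satRest =
    Saturating-mono (p⊆q∪[p∩∁q] T Y) ([p∩q]∪[p∩∁q]⊆p R (N G Y)) (Saturating-∪ disjoint (Saturating-N satY) satRest)
    where
    disjoint : Empty ((R ∩ N G Y) ∩ R ∩ ∁ (N G Y))
    disjoint (v , v∈) = let v∈R∩NY , v∈R∖NY = x∈p∩q⁻ (R ∩ N G Y) _ v∈
                        in x∈∁p⇒x∉p (p∩q⊆q R _ v∈R∖NY) (p∩q⊆q R _ v∈R∩NY)

  Saturating-add : ∀ {T R t r} → Adj t r → r ∈ R → Saturating (T ∩ ∁ ⁅ t ⁆) (R ∩ ∁ ⁅ r ⁆) → Saturating T R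
  Saturating-add {T} {R} {t} {r} tr r∈R satRest =
    Saturating-mono (p⊆q∪[p∩∁q] T ⁅ t ⁆) ⁅r⁆∪R∖r⊆R (Saturating-∪ disjoint (Saturating-⁅⁆ tr) satRest)
    where
    disjoint : Empty (⁅ r ⁆ ∩ R ∩ ∁ ⁅ r ⁆)
    disjoint (v , v∈) = let v∈⁅r⁆ , v∈R∖r = x∈p∩q⁻ ⁅ r ⁆ _ v∈ in x∈∁p⇒x∉p (p∩q⊆q R _ v∈R∖r) v∈⁅r⁆
    ⁅r⁆∪R∖r⊆R : ⁅ r ⁆ ∪ R ∩ ∁ ⁅ r ⁆ ⊆ R
    ⁅r⁆∪R∖r⊆R v∈ with x∈p∪q⁻ ⁅ r ⁆ _ v∈
    ... | inj₁ v∈⁅r⁆ = subst (_∈ R) (sym (x∈⁅y⁆⇒x≡y r v∈⁅r⁆)) r∈R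
    ... | inj₂ v∈R∖r = p∩q⊆p R _ v∈R∖r

  HallCondition-⊆ : ∀ {Y T R} → Y ⊆ T → HallCondition T R → HallCondition Y R
  HallCondition-⊆ Y⊆T hall Z Z⊆Y = hall Z (Y⊆T ∘ Z⊆Y)

  HallCondition⇒neighbour : ∀ {T R t} → HallCondition T R → t ∈ T → ∃ λ r → r ∈ R × Adj t r
  HallCondition⇒neighbour {T} {R} {t} hall t∈T
    with ∣p∣>0⇒Nonempty (R ∩ N G ⁅ t ⁆) (subst (_≤ ∣ R ∩ N G ⁅ t ⁆ ∣) (∣⁅x⁆∣≡1 t) (hall ⁅ t ⁆ ⁅t⁆⊆T))
    where
    ⁅t⁆⊆T : ⁅ t ⁆ ⊆ T
    ⁅t⁆⊆T u∈ = subst (_∈ T) (sym (x∈⁅y⁆⇒x≡y t u∈)) t∈T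
  ... | r , r∈ with x∈p∩q⁻ R _ r∈
  ...   | r∈R , r∈N⁅t⁆ with ∈N⁻ r∈N⁅t⁆
  ...     | u , u∈⁅t⁆ , ur = r , r∈R , subst (λ u → Adj u r) (x∈⁅y⁆⇒x≡y t u∈⁅t⁆) ur

  -- If some proper nonempty Y ⊆ T is tight, Y and T ∖ Y are matched
  -- separately (into R ∩ N Y and R ∖ N Y); otherwise every Hall inequality is strict, so
  -- matching any t ∈ T to a neighbour r ∈ R keeps Hall's condition for T ∖ t and R ∖ r.
  hall : ∀ k T R → ∣ T ∣ ≤ k → HallCondition T R → Saturating T R
  hall zero T R ∣T∣≤0 _ = Saturating-∅ λ (t , t∈T) → ℕ.n≮0 (ℕ.<-≤-trans (x∈p⇒∣p∩∁⁅x⁆∣<∣p∣ t∈T) ∣T∣≤0)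
  hall (suc k) T R ∣T∣≤1+k cond with anySubset? (tight? T R)
  ... | yes (Y , tight@(Y⊆T , ∣Y∣>0 , ∣Y∣<∣T∣ , _)) =
    Saturating-split Y (hall k Y R (shrink ∣Y∣<∣T∣) (HallCondition-⊆ {R = R} Y⊆T cond))
                       (hall k (T ∩ ∁ Y) (R ∩ ∁ (N G Y)) (shrink ∣T∖Y∣<∣T∣) (HallCondition-tight T R tight cond))
    where
    shrink : ∀ {m} → m < ∣ T ∣ → m ≤ k
    shrink m<∣T∣ = ℕ.≤-pred (ℕ.<-≤-trans m<∣T∣ ∣T∣≤1+k)
    ∣T∖Y∣<∣T∣ : ∣ T ∩ ∁ Y ∣ < ∣ T ∣
    ∣T∖Y∣<∣T∣ = ∣p∩q∣>0⇒∣p∩∁q∣<∣p∣ T Y (ℕ.<-≤-trans ∣Y∣>0 (p⊆q⇒∣p∣≤∣q∣ λ v∈Y → x∈p∩q⁺ (Y⊆T v∈Y , v∈Y)))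
  ... | no loose with nonempty? T
  ...   | no T=∅ = Saturating-∅ T=∅
  ...   | yes (t , t∈T) with HallCondition⇒neighbour cond t∈T
  ...     | r , r∈R , tr = Saturating-add tr r∈R
    (hall k (T ∩ ∁ ⁅ t ⁆) (R ∩ ∁ ⁅ r ⁆) (ℕ.≤-pred (ℕ.<-≤-trans (x∈p⇒∣p∩∁⁅x⁆∣<∣p∣ t∈T) ∣T∣≤1+k))
      (HallCondition-loose T R r (λ Y → loose ∘ (Y ,_)) t∈T cond))

  Hall : ∀ {T R} → HallCondition T R → Saturating T R
  Hall {T} {R} = hall ∣ T ∣ T R ℕ.≤-refl

  -- König–Egerváry graphs

  matching≤∣∁S∣ : ∀ {S} → Independent S → ∀ M → IsMatching G M → length M ≤ ∣ ∁ S ∣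
  matching≤∣∁S∣ {S} I M (edges , uniq) = subst (_≤ ∣ ∁ S ∣) (List.length-map outside M)
    (Unique⇒length≤∣p∣ (map outside M) (∁ S) (outside-unique M uniq) (Allₚ.map⁺ (All.map outside∈∁S edges)))
    where
    outside : Fin n × Fin n → Fin n
    outside (u , v) with u ∈? S
    ... | yes _ = v
    ... | no  _ = u

    outside∈∁S : ∀ {e} → Adj (proj₁ e) (proj₂ e) → outside e ∈ ∁ S
    outside∈∁S {u , v} uv with u ∈? S
    ... | yes u∈S = x∉p⇒x∈∁p λ v∈S → nonadjacent I u∈S v∈S uv
    ... | no u∉S  = x∉p⇒x∈∁p u∉S

    outside-endpoint : ∀ e {w} → outside e ≡ w → proj₁ e ≡ w ⊎ proj₂ e ≡ w
    outside-endpoint (u , v) eq with u ∈? S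
    ... | yes _ = inj₂ eq
    ... | no  _ = inj₁ eq

    outside-∈ : ∀ M {w} → w ∈ₗ map outside M → w ∈ₗ endpoints M
    outside-∈ (e ∷ M) (here refl) with outside-endpoint e refl
    ... | inj₁ eq = here (sym eq)
    ... | inj₂ eq = there (here (sym eq))
    outside-∈ (e ∷ M) (there w∈) = there (there (outside-∈ M w∈))

    outside-unique : ∀ M → Unique (endpoints M) → Unique (map outside M)
    outside-unique [] _ = []
    outside-unique (e ∷ M) ((_ ∷ u∉) ∷ v∉ ∷ uniq) =
      All.tabulate (λ w∈ eq → case outside-endpoint e eq of λ where
                      (inj₁ refl) → All.lookup u∉ (outside-∈ M w∈) refl
                      (inj₂ refl) → All.lookup v∉ (outside-∈ M w∈) refl)
      ∷ outside-unique M uniq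

  Saturating⇒matching : ∀ {T R} → Empty (T ∩ R) → Saturating T R →
    ∃ λ M → IsMatching G M × length M ≡ ∣ T ∣
  Saturating⇒matching {T} {R} T∩R=∅ (f , f∈R , f-inj) =
    map edge (elements T) ,
    (Allₚ.map⁺ (All.tabulate (proj₂ ∘ f∈R ∘ ∈-elements⁻ T)) , unique (elements T) (elements-unique T) (∈-elements⁻ T)) ,
    trans (List.length-map edge (elements T)) (length-elements T)
    where
    edge : Fin n → Fin n × Fin n
    edge t = t , f t

    T∌R : ∀ {t r} → t ∈ T → r ∈ R → t ≢ r
    T∌R t∈T r∈R refl = T∩R=∅ (_ , x∈p∩q⁺ (t∈T , r∈R))

    endpoint⁻ : ∀ xs {w} → w ∈ₗ endpoints (map edge xs) → ∃ λ x → x ∈ₗ xs × (w ≡ x ⊎ w ≡ f x)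
    endpoint⁻ (x ∷ xs) (here refl)         = x , here refl , inj₁ refl
    endpoint⁻ (x ∷ xs) (there (here refl)) = x , here refl , inj₂ refl
    endpoint⁻ (x ∷ xs) (there (there w∈))  = let y , y∈ , eq = endpoint⁻ xs w∈ in y , there y∈ , eq

    unique : ∀ xs → Unique xs → (∀ {x} → x ∈ₗ xs → x ∈ T) → Unique (endpoints (map edge xs))
    unique [] _ _ = []
    unique (x ∷ xs) (x∉xs ∷ uniq) xs⊆T = (x≢fx ∷ All.tabulate x∉) ∷ All.tabulate fx∉ ∷ unique xs uniq (xs⊆T ∘ there)
      where
      x∈T : x ∈ T
      x∈T = xs⊆T (here refl)
      x≢fx : x ≢ f x
      x≢fx = T∌R x∈T (proj₁ (f∈R x∈T))
      x∉ : ∀ {w} → w ∈ₗ endpoints (map edge xs) → x ≢ w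
      x∉ w∈ x≡w with endpoint⁻ xs w∈
      ... | y , y∈ , inj₁ w≡y  = All.lookup x∉xs y∈ (trans x≡w w≡y)
      ... | y , y∈ , inj₂ w≡fy = T∌R x∈T (proj₁ (f∈R (xs⊆T (there y∈)))) (trans x≡w w≡fy)
      fx∉ : ∀ {w} → w ∈ₗ endpoints (map edge xs) → f x ≢ w
      fx∉ w∈ fx≡w with endpoint⁻ xs w∈
      ... | y , y∈ , inj₁ w≡y  = T∌R (xs⊆T (there y∈)) (proj₁ (f∈R x∈T)) (sym (trans fx≡w w≡y))
      ... | y , y∈ , inj₂ w≡fy = All.lookup x∉xs y∈ (f-inj x∈T (xs⊆T (there y∈)) (trans fx≡w w≡fy))

  -- 2α − n, written as α − μ for the μ = n − α that a König–Egerváry graph must have.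
  δ : ℤ
  δ = ℤ.+ α G ℤ.- ℤ.+ (n ∸ α G)

  ∣∁S∣≡n∸α : ∀ {S} → MaximumIndependent S → ∣ ∁ S ∣ ≡ n ∸ α G
  ∣∁S∣≡n∸α {S} (_ , ∣S∣≡α) = trans (∣∁p∣≡n∸∣p∣ S) (cong (n ∸_) ∣S∣≡α)

  α≤n : α G ≤ n
  α≤n = let S , _ , ∣S∣≡α = maximumIndependent in subst (_≤ n) ∣S∣≡α (∣p∣≤n S)

  dIndep≤δ⇒HallCondition : dIndep G ℤ.≤ δ → ∀ {S} → MaximumIndependent S → HallCondition (∁ S) S
  dIndep≤δ⇒HallCondition dIndep≤δ {S} M@(I , ∣S∣≡α) Y Y⊆∁S =
    ℕ.+-cancelʳ-≤ (∣ S′ ∣ + (n ∸ α G)) ∣ Y ∣ ∣ S ∩ N G Y ∣ (begin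
      ∣ Y ∣ + (∣ S′ ∣ + (n ∸ α G))               ≤⟨ ℕ.+-monoʳ-≤ ∣ Y ∣ dS′≤δ ⟩
      ∣ Y ∣ + (α G + ∣ N G S′ ∣)                 ≤⟨ ℕ.+-monoʳ-≤ ∣ Y ∣ (ℕ.+-monoʳ-≤ (α G) ∣NS′∣≤) ⟩
      ∣ Y ∣ + (α G + ∣ ∁ S ∩ ∁ Y ∣)              ≡⟨ ℕ.+-comm ∣ Y ∣ _ ⟩
      α G + ∣ ∁ S ∩ ∁ Y ∣ + ∣ Y ∣                ≡⟨ ℕ.+-assoc (α G) _ _ ⟩
      α G + (∣ ∁ S ∩ ∁ Y ∣ + ∣ Y ∣)              ≤⟨ ℕ.+-monoʳ-≤ (α G) ∣∁S∩∁Y∣+∣Y∣≤ ⟩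
      α G + (n ∸ α G)                            ≡⟨ cong (_+ (n ∸ α G)) (sym ∣S∩NY∣+∣S′∣≡α) ⟩
      ∣ S ∩ N G Y ∣ + ∣ S′ ∣ + (n ∸ α G)         ≡⟨ ℕ.+-assoc ∣ S ∩ N G Y ∣ _ _ ⟩
      ∣ S ∩ N G Y ∣ + (∣ S′ ∣ + (n ∸ α G))       ∎)
    where
    open ℕ.≤-Reasoning
    S′ : Subset n
    S′ = S ∩ ∁ (N G Y)
    dS′≤δ : ∣ S′ ∣ + (n ∸ α G) ≤ α G + ∣ N G S′ ∣
    dS′≤δ = Equivalence.to (-≤-⇔+≤+ ∣ S′ ∣ ∣ N G S′ ∣ (α G) (n ∸ α G))
      (ℤ.≤-trans (dIndep-upper (Independent-⊆ (p∩q⊆p S (∁ (N G Y))) I)) dIndep≤δ)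
    ∣NS′∣≤ : ∣ N G S′ ∣ ≤ ∣ ∁ S ∩ ∁ Y ∣
    ∣NS′∣≤ = p⊆q⇒∣p∣≤∣q∣ {p = N G S′} {q = ∁ S ∩ ∁ Y} λ v∈ →
      let u , u∈S′ , uv = ∈N⁻ v∈ ; u∈S , u∉NY = x∈p∩q⁻ S _ u∈S′
      in x∈p∩q⁺ ( x∉p⇒x∈∁p (λ v∈S → nonadjacent I u∈S v∈S uv)
                , x∉p⇒x∈∁p (λ v∈Y → x∈∁p⇒x∉p u∉NY (∈N⁺ v∈Y (Adj-sym uv))))
    ∣∁S∩∁Y∣+∣Y∣≤ : ∣ ∁ S ∩ ∁ Y ∣ + ∣ Y ∣ ≤ n ∸ α G
    ∣∁S∩∁Y∣+∣Y∣≤ = begin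
      ∣ ∁ S ∩ ∁ Y ∣ + ∣ Y ∣            ≤⟨ ℕ.+-monoʳ-≤ (∣ ∁ S ∩ ∁ Y ∣) (p⊆q⇒∣p∣≤∣q∣ λ v∈Y → x∈p∩q⁺ (Y⊆∁S v∈Y , v∈Y)) ⟩
      ∣ ∁ S ∩ ∁ Y ∣ + ∣ ∁ S ∩ Y ∣      ≡⟨ ℕ.+-comm (∣ ∁ S ∩ ∁ Y ∣) (∣ ∁ S ∩ Y ∣) ⟩
      ∣ ∁ S ∩ Y ∣ + ∣ ∁ S ∩ ∁ Y ∣      ≡⟨ ∣p∩q∣+∣p∩∁q∣≡∣p∣ (∁ S) Y ⟩
      ∣ ∁ S ∣                          ≡⟨ ∣∁S∣≡n∸α M ⟩
      n ∸ α G                          ∎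
    ∣S∩NY∣+∣S′∣≡α : ∣ S ∩ N G Y ∣ + ∣ S′ ∣ ≡ α G
    ∣S∩NY∣+∣S′∣≡α = trans (∣p∩q∣+∣p∩∁q∣≡∣p∣ S (N G Y)) ∣S∣≡α

  dIndep≤δ⇒KE : dIndep G ℤ.≤ δ → KönigEgerváry G
  dIndep≤δ⇒KE dIndep≤δ with maximumIndependent
  ... | S , maxS with Saturating⇒matching ∁S∩S=∅ (Hall (dIndep≤δ⇒HallCondition dIndep≤δ maxS))
    where
    ∁S∩S=∅ : Empty (∁ S ∩ S)
    ∁S∩S=∅ (v , v∈) = ∉⊥ (subst (v ∈_) (∩-inverseˡ S) v∈)
  ...   | M , isMatching , ∣M∣≡∣∁S∣ =
    n ∸ α G , ((M , isMatching , trans ∣M∣≡∣∁S∣ (∣∁S∣≡n∸α maxS)) , upper) , ℕ.m+[n∸m]≡n α≤n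
    where
    upper : ∀ M′ → IsMatching G M′ → length M′ ≤ n ∸ α G
    upper M′ isM′ = subst (length M′ ≤_) (∣∁S∣≡n∸α maxS) (matching≤∣∁S∣ (proj₁ maxS) M′ isM′)

  partner-matched : ∀ M → IsMatching G M → ∀ {x} → x ∈ₗ endpoints M →
    Adj x (partner M x) × partner M x ∈ₗ endpoints M × partner M (partner M x) ≡ x
  partner-matched ((u , v) ∷ M) (uv ∷ _ , (u≢v ∷ _) ∷ _) (here refl) =
    subst (Adj u) (sym (partner-∷-left M u v)) uv ,
    subst (_∈ₗ u ∷ v ∷ endpoints M) (sym (partner-∷-left M u v)) (there (here refl)) ,
    trans (cong (partner ((u , v) ∷ M)) (partner-∷-left M u v)) (partner-∷-right M u v u≢v)
  partner-matched ((u , v) ∷ M) (uv ∷ _ , (u≢v ∷ _) ∷ _) (there (here refl)) =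
    subst (Adj v) (sym (partner-∷-right M u v u≢v)) (Adj-sym uv) ,
    subst (_∈ₗ u ∷ v ∷ endpoints M) (sym (partner-∷-right M u v u≢v)) (here refl) ,
    trans (cong (partner ((u , v) ∷ M)) (partner-∷-right M u v u≢v)) (partner-∷-left M u v)
  partner-matched ((u , v) ∷ M) (_ ∷ edges , (_ ∷ u∉) ∷ v∉ ∷ uniq) {x} (there (there x∈))
    with partner-matched M (edges , uniq) x∈
  ... | x~y , y∈ , y↦x =
    subst (Adj x) (sym (skip x∈)) x~y ,
    subst (_∈ₗ u ∷ v ∷ endpoints M) (sym (skip x∈)) (there (there y∈)) ,
    trans (cong (partner ((u , v) ∷ M)) (skip x∈)) (trans (skip y∈) y↦x)
    where
    skip : ∀ {w} → w ∈ₗ endpoints M → partner ((u , v) ∷ M) w ≡ partner M w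
    skip w∈ = partner-∷-other M u v (λ w≡u → All.lookup u∉ w∈ (sym w≡u)) (λ w≡v → All.lookup v∉ w∈ (sym w≡v))

  KE⇒d≤δ : KönigEgerváry G → ∀ X → d G X ℤ.≤ δ
  KE⇒d≤δ (μ , ((M , isM@(_ , uniq) , ∣M∣≡μ) , _) , α+μ≡n) X =
    Equivalence.from (-≤-⇔+≤+ ∣ X ∣ ∣ N G X ∣ (α G) (n ∸ α G)) (begin
      ∣ X ∣ + (n ∸ α G)                                ≡⟨ cong₂ _+_ (sym (∣p∩q∣+∣p∩∁q∣≡∣p∣ X P)) n∸α≡μ ⟩
      ∣ X ∩ P ∣ + ∣ X ∩ ∁ P ∣ + μ                      ≤⟨ ℕ.+-monoˡ-≤ μ (ℕ.+-mono-≤ ∣X∩P∣≤∣NX∣ (∣p∩q∣≤∣q∣ X (∁ P))) ⟩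
      ∣ N G X ∣ + ∣ ∁ P ∣ + μ                          ≡⟨ ℕ.+-assoc ∣ N G X ∣ _ _ ⟩
      ∣ N G X ∣ + (∣ ∁ P ∣ + μ)                        ≤⟨ ℕ.+-monoʳ-≤ ∣ N G X ∣ ∣∁P∣+μ≤α ⟩
      ∣ N G X ∣ + α G                                  ≡⟨ ℕ.+-comm ∣ N G X ∣ (α G) ⟩
      α G + ∣ N G X ∣                                  ∎)
    where
    open ℕ.≤-Reasoning
    P : Subset n
    P = fromList (endpoints M)
    n∸α≡μ : n ∸ α G ≡ μ
    n∸α≡μ = trans (cong (_∸ α G) (sym α+μ≡n)) (ℕ.m+n∸m≡n (α G) μ)
    ∣X∩P∣≤∣NX∣ : ∣ X ∩ P ∣ ≤ ∣ N G X ∣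
    ∣X∩P∣≤∣NX∣ = injectiveOn⇒∣p∣≤∣q∣ (X ∩ P) (N G X) (partner M)
      (λ x∈ → ∈N⁺ (p∩q⊆p X P x∈) (proj₁ (matched x∈)))
      (λ x∈ y∈ eq → trans (sym (proj₂ (proj₂ (matched x∈)))) (trans (cong (partner M) eq) (proj₂ (proj₂ (matched y∈)))))
      where
      matched : ∀ {x} → x ∈ X ∩ P → Adj x (partner M x) × partner M x ∈ₗ endpoints M × partner M (partner M x) ≡ x
      matched x∈ = partner-matched M isM (∈-fromList⁻ (endpoints M) (p∩q⊆q X P x∈))
    μ+μ≤∣P∣ : μ + μ ≤ ∣ P ∣
    μ+μ≤∣P∣ = subst (_≤ ∣ P ∣) (trans (length-endpoints M) (cong₂ _+_ ∣M∣≡μ ∣M∣≡μ))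
      (Unique⇒length≤∣p∣ (endpoints M) P uniq (All.tabulate (∈-fromList⁺ (endpoints M))))
    ∣∁P∣+μ≤α : ∣ ∁ P ∣ + μ ≤ α G
    ∣∁P∣+μ≤α = ℕ.+-cancelʳ-≤ μ (∣ ∁ P ∣ + μ) (α G) (begin
      ∣ ∁ P ∣ + μ + μ       ≡⟨ ℕ.+-assoc ∣ ∁ P ∣ μ μ ⟩
      ∣ ∁ P ∣ + (μ + μ)     ≤⟨ ℕ.+-monoʳ-≤ ∣ ∁ P ∣ μ+μ≤∣P∣ ⟩
      ∣ ∁ P ∣ + ∣ P ∣       ≡⟨ ℕ.+-comm ∣ ∁ P ∣ ∣ P ∣ ⟩
      ∣ P ∣ + ∣ ∁ P ∣       ≡⟨ trans (cong (_+_ ∣ P ∣) (∣∁p∣≡n∸∣p∣ P)) (ℕ.m+[n∸m]≡n (∣p∣≤n P)) ⟩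
      n                     ≡⟨ sym α+μ≡n ⟩
      α G + μ               ∎)

  δ≤d-maximum : ∀ {S} → MaximumIndependent S → δ ℤ.≤ d G S
  δ≤d-maximum {S} M@(I , ∣S∣≡α) = Equivalence.from (-≤-⇔+≤+ (α G) (n ∸ α G) ∣ S ∣ ∣ N G S ∣)
    (subst (λ s → α G + ∣ N G S ∣ ≤ s + (n ∸ α G)) (sym ∣S∣≡α)
      (ℕ.+-monoʳ-≤ (α G) (subst (∣ N G S ∣ ≤_) (∣∁S∣≡n∸α M) (p⊆q⇒∣p∣≤∣q∣ (N-Independent I)))))

  KE⇒dG≡δ : KönigEgerváry G → dG G ≡ δ
  KE⇒dG≡δ ke with maximumIndependent
  ... | S , M = ℤ.≤-antisym (dG-lub (KE⇒d≤δ ke)) (ℤ.≤-trans (δ≤d-maximum M) (dG-upper S))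

  KE⇒d-maximum≡δ : KönigEgerváry G → ∀ {S} → MaximumIndependent S → d G S ≡ δ
  KE⇒d-maximum≡δ ke {S} M = ℤ.≤-antisym (ℤ.≤-trans (dG-upper S) (ℤ.≤-reflexive (KE⇒dG≡δ ke))) (δ≤d-maximum M)

  KE⇒dIndep≡δ : KönigEgerváry G → dIndep G ≡ δ
  KE⇒dIndep≡δ ke with maximumIndependent
  ... | S , M = ℤ.≤-antisym (ℤ.≤-trans dIndep≤dG (ℤ.≤-reflexive (KE⇒dG≡δ ke)))
                            (ℤ.≤-trans (δ≤d-maximum M) (dIndep-upper (proj₁ M)))

  KE⇒corona-critical : KönigEgerváry G → Critical G (corona G)
  KE⇒corona-critical ke = ℤ.≤-antisym (dG-upper (corona G))
    (d-unionOf-≥ (isMaxIndep? G) (proj₁ maximumIndependent) (isMaxIndep?⁺ (proj₂ maximumIndependent))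
      (λ {S} max → ℤ.≤-reflexive (trans (KE⇒dG≡δ ke) (sym (KE⇒d-maximum≡δ ke (isMaxIndep?⁻ {S} max)))))
      (λ {S} X _ → dG-upper (S ∩ X)))

  dIndep≤d-diadem : dIndep G ℤ.≤ d G (diadem G)
  dIndep≤d-diadem =
    d-unionOf-≥ (isCritIndep? G) (proj₁ criticalIndependent) (isCritIndep?⁺ (proj₂ criticalIndependent))
    (λ {A} crit → ℤ.≤-reflexive (sym (proj₂ (isCritIndep?⁻ {A} crit))))
    (λ {A} X crit → dIndep-upper (Independent-⊆ (p∩q⊆p A X) (proj₁ (isCritIndep?⁻ {A} crit))))

  ∣core∣+∣corona∣≡2α⇔d-corona≡δ : (∣ core G ∣ + ∣ corona G ∣ ≡ 2 * α G) ⇔ (d G (corona G) ≡ δ)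
  ∣core∣+∣corona∣≡2α⇔d-corona≡δ = mk⇔
    (λ eq → begin
      d G (corona G)                   ≡⟨ d-corona ⟩
      [ ∣ corona G ∣ + ∣ core G ∣ ]-n  ≡⟨ cong [_]-n (trans (ℕ.+-comm (∣ corona G ∣) (∣ core G ∣)) (trans eq 2α≡α+α)) ⟩
      [ α G + α G ]-n                  ≡⟨ sym δ≡ ⟩
      δ                                ∎)
    (λ eq → begin
      ∣ core G ∣ + ∣ corona G ∣        ≡⟨ ℕ.+-comm (∣ core G ∣) (∣ corona G ∣) ⟩
      ∣ corona G ∣ + ∣ core G ∣        ≡⟨ []-n-injective (trans (sym d-corona) (trans eq δ≡)) ⟩
      α G + α G                        ≡⟨ sym 2α≡α+α ⟩
      2 * α G                          ∎)
    where
    open ≡-Reasoning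
    [_]-n : ℕ → ℤ
    [ s ]-n = ℤ.+ s ℤ.- ℤ.+ n
    []-n-injective : ∀ {s t} → [ s ]-n ≡ [ t ]-n → s ≡ t
    []-n-injective {s} {t} eq = ℕ.+-cancelʳ-≡ n s t (Equivalence.to (-≡-⇔+≡+ s n t n) eq)
    d-corona : d G (corona G) ≡ [ ∣ corona G ∣ + ∣ core G ∣ ]-n
    d-corona = trans (cong (λ k → ℤ.+ ∣ corona G ∣ ℤ.- ℤ.+ k) (trans (cong ∣_∣ N-corona≡∁core) (∣∁p∣≡n∸∣p∣ (core G))))
                     ([a]-[m∸b]≡[a+b]-[m] ∣ corona G ∣ (∣p∣≤n (core G)))
    δ≡ : δ ≡ [ α G + α G ]-n
    δ≡ = [a]-[m∸b]≡[a+b]-[m] (α G) α≤n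
    2α≡α+α : 2 * α G ≡ α G + α G
    2α≡α+α = cong (α G +_) (ℕ.+-identityʳ (α G))

  -- Supermodularity makes A ∩ S critical too, and d(A ∩ S) = d(A) bounds |A ∩ S| + |S ∩ N(A)| by |A|,
  -- as S ∩ N(A) and N(A ∩ S) are disjoint parts of N(A); hence |A ∪ (S ∖ N(A))| ≥ |S|.
  critical∪maximum∖N-maximum : ∀ {A S} → Independent A → d G A ≡ dG G → MaximumIndependent S → d G S ≡ dG G →
    MaximumIndependent (A ∪ S ∩ ∁ (N G A))
  critical∪maximum∖N-maximum {A} {S} IA dA≡dG (IS , ∣S∣≡α) dS≡dG =
    I , ℕ.≤-antisym (α-upper I) (ℕ.+-cancelʳ-≤ (∣ A ∣) (α G) (∣ A ∪ S∖NA ∣) α+∣A∣≤∣A∪S∖NA∣+∣A∣)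
    where
    X S∖NA : Subset n
    X = A ∩ S
    S∖NA = S ∩ ∁ (N G A)

    I : Independent (A ∪ S∖NA)
    I = Independent-∪ IA (Independent-⊆ (p∩q⊆p S _) IS) (x∈∁p⇒x∉p ∘ p∩q⊆q S _)

    dX≡dG : d G X ≡ dG G
    dX≡dG = ℤ.≤-antisym (dG-upper X) (ℤ+-cancelʳ-≤ (dG G) (begin
      dG G ℤ.+ dG G                   ≡⟨ sym (cong₂ ℤ._+_ dA≡dG dS≡dG) ⟩
      d G A ℤ.+ d G S                 ≤⟨ d-supermodular A S ⟩
      d G (A ∪ S) ℤ.+ d G X           ≤⟨ ℤ.+-monoˡ-≤ (d G X) (dG-upper (A ∪ S)) ⟩
      dG G ℤ.+ d G X                  ≡⟨ ℤ.+-comm (dG G) (d G X) ⟩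
      d G X ℤ.+ dG G                  ∎))
      where open ℤ.≤-Reasoning

    ∣X∣+∣NA∣≡∣A∣+∣NX∣ : ∣ X ∣ + ∣ N G A ∣ ≡ ∣ A ∣ + ∣ N G X ∣
    ∣X∣+∣NA∣≡∣A∣+∣NX∣ = Equivalence.to (-≡-⇔+≡+ (∣ X ∣) (∣ N G X ∣) (∣ A ∣) (∣ N G A ∣)) (trans dX≡dG (sym dA≡dG))

    S∩NA∩NX=∅ : Empty ((S ∩ N G A) ∩ N G X)
    S∩NA∩NX=∅ (v , v∈) =
      let v∈S∩NA , v∈NX = x∈p∩q⁻ (S ∩ N G A) (N G X) v∈ ; u , u∈X , uv = ∈N⁻ v∈NX
      in nonadjacent IS (p∩q⊆q A S u∈X) (p∩q⊆p S _ v∈S∩NA) uv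

    ∣X∣+∣S∩NA∣≤∣A∣ : ∣ X ∣ + ∣ S ∩ N G A ∣ ≤ ∣ A ∣
    ∣X∣+∣S∩NA∣≤∣A∣ = ℕ.+-cancelʳ-≤ (∣ N G X ∣) (∣ X ∣ + ∣ S ∩ N G A ∣) (∣ A ∣) (begin
      ∣ X ∣ + ∣ S ∩ N G A ∣ + ∣ N G X ∣
        ≡⟨ ℕ.+-assoc (∣ X ∣) (∣ S ∩ N G A ∣) (∣ N G X ∣) ⟩
      ∣ X ∣ + (∣ S ∩ N G A ∣ + ∣ N G X ∣)
        ≡⟨ cong (∣ X ∣ +_) (sym (Disjoint⇒∣p∪q∣≡∣p∣+∣q∣ (S ∩ N G A) (N G X) S∩NA∩NX=∅)) ⟩
      ∣ X ∣ + ∣ S ∩ N G A ∪ N G X ∣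
        ≤⟨ ℕ.+-monoʳ-≤ (∣ X ∣) (p⊆q⇒∣p∣≤∣q∣ S∩NA∪NX⊆NA) ⟩
      ∣ X ∣ + ∣ N G A ∣
        ≡⟨ ∣X∣+∣NA∣≡∣A∣+∣NX∣ ⟩
      ∣ A ∣ + ∣ N G X ∣
        ∎)
      where
      open ℕ.≤-Reasoning
      S∩NA∪NX⊆NA : S ∩ N G A ∪ N G X ⊆ N G A
      S∩NA∪NX⊆NA v∈ with x∈p∪q⁻ (S ∩ N G A) (N G X) v∈
      ... | inj₁ v∈S∩NA = p∩q⊆q S (N G A) v∈S∩NA
      ... | inj₂ v∈NX   = N-mono (p∩q⊆p A S) v∈NX

    α+∣A∣≤∣A∪S∖NA∣+∣A∣ : α G + ∣ A ∣ ≤ ∣ A ∪ S∖NA ∣ + ∣ A ∣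
    α+∣A∣≤∣A∪S∖NA∣+∣A∣ = begin
      α G + ∣ A ∣
        ≡⟨ cong (_+ ∣ A ∣) (sym (trans (∣p∩q∣+∣p∩∁q∣≡∣p∣ S (N G A)) ∣S∣≡α)) ⟩
      ∣ S ∩ N G A ∣ + ∣ S∖NA ∣ + ∣ A ∣
        ≡⟨ ℕ.+-assoc (∣ S ∩ N G A ∣) (∣ S∖NA ∣) (∣ A ∣) ⟩
      ∣ S ∩ N G A ∣ + (∣ S∖NA ∣ + ∣ A ∣)
        ≡⟨ cong (∣ S ∩ N G A ∣ +_) (trans (ℕ.+-comm (∣ S∖NA ∣) (∣ A ∣)) (sym (∣p∪q∣+∣p∩q∣≡∣p∣+∣q∣ A S∖NA))) ⟩
      ∣ S ∩ N G A ∣ + (∣ A ∪ S∖NA ∣ + ∣ A ∩ S∖NA ∣)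
        ≤⟨ ℕ.+-monoʳ-≤ (∣ S ∩ N G A ∣) (ℕ.+-monoʳ-≤ (∣ A ∪ S∖NA ∣) ∣A∩S∖NA∣≤∣X∣) ⟩
      ∣ S ∩ N G A ∣ + (∣ A ∪ S∖NA ∣ + ∣ X ∣)
        ≡⟨ ℕ.+-comm (∣ S ∩ N G A ∣) (∣ A ∪ S∖NA ∣ + ∣ X ∣) ⟩
      ∣ A ∪ S∖NA ∣ + ∣ X ∣ + ∣ S ∩ N G A ∣
        ≡⟨ ℕ.+-assoc (∣ A ∪ S∖NA ∣) (∣ X ∣) (∣ S ∩ N G A ∣) ⟩
      ∣ A ∪ S∖NA ∣ + (∣ X ∣ + ∣ S ∩ N G A ∣)
        ≤⟨ ℕ.+-monoʳ-≤ (∣ A ∪ S∖NA ∣) ∣X∣+∣S∩NA∣≤∣A∣ ⟩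
      ∣ A ∪ S∖NA ∣ + ∣ A ∣
        ∎
      where
      open ℕ.≤-Reasoning
      ∣A∩S∖NA∣≤∣X∣ : ∣ A ∩ S∖NA ∣ ≤ ∣ X ∣
      ∣A∩S∖NA∣≤∣X∣ = p⊆q⇒∣p∣≤∣q∣ λ v∈ →
        let v∈A , v∈S∖NA = x∈p∩q⁻ A S∖NA v∈ in x∈p∩q⁺ (v∈A , p∩q⊆p S _ v∈S∖NA)

  KE⇒diadem≡corona : KönigEgerváry G → diadem G ≡ corona G
  KE⇒diadem≡corona ke = ⊆-antisym diadem⊆corona corona⊆diadem
    where
    dIndep≡dG : dIndep G ≡ dG G
    dIndep≡dG = trans (KE⇒dIndep≡δ ke) (sym (KE⇒dG≡δ ke))
    maximum-critical : ∀ {S} → MaximumIndependent S → d G S ≡ dG G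
    maximum-critical M = trans (KE⇒d-maximum≡δ ke M) (sym (KE⇒dG≡δ ke))
    diadem⊆corona : diadem G ⊆ corona G
    diadem⊆corona v∈ with diadem⁻ v∈ | maximumIndependent
    ... | A , (IA , dA≡dIndep) , v∈A | S , M =
      corona⁺ (critical∪maximum∖N-maximum IA (trans dA≡dIndep dIndep≡dG) M (maximum-critical M)) (x∈p∪q⁺ (inj₁ v∈A))
    corona⊆diadem : corona G ⊆ diadem G
    corona⊆diadem v∈ with corona⁻ v∈
    ... | S , M , v∈S = diadem⁺ (proj₁ M , trans (maximum-critical M) (sym dIndep≡dG)) v∈S

  KE⇒∣core∣+∣corona∣≡2α : KönigEgerváry G → ∣ core G ∣ + ∣ corona G ∣ ≡ 2 * α G
  KE⇒∣core∣+∣corona∣≡2α ke =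
    Equivalence.from ∣core∣+∣corona∣≡2α⇔d-corona≡δ (trans (KE⇒corona-critical ke) (KE⇒dG≡δ ke))

  diadem≡corona⇒KE : diadem G ≡ corona G → ∣ core G ∣ + ∣ corona G ∣ ≡ 2 * α G → KönigEgerváry G
  diadem≡corona⇒KE diadem≡corona sizes = dIndep≤δ⇒KE (subst (dIndep G ℤ.≤_)
    (trans (cong (d G) diadem≡corona) (Equivalence.to ∣core∣+∣corona∣≡2α⇔d-corona≡δ sizes)) dIndep≤d-diadem)

  corona-critical⇒KE : Critical G (corona G) → ∣ core G ∣ + ∣ corona G ∣ ≡ 2 * α G → KönigEgerváry G
  corona-critical⇒KE critical sizes = dIndep≤δ⇒KE (ℤ.≤-trans dIndep≤dG
    (ℤ.≤-reflexive (trans (sym critical) (Equivalence.to ∣core∣+∣corona∣≡2α⇔d-corona≡δ sizes))))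

corollary4p2 : ∀ {n : ℕ} (G : Graph n) →
    (KönigEgerváry G ⇔ ((diadem G ≡ corona G) × (∣ core G ∣ + ∣ corona G ∣ ≡ 2 * α G)))
    × (KönigEgerváry G ⇔ (Critical G (corona G) × (∣ core G ∣ + ∣ corona G ∣ ≡ 2 * α G)))
corollary4p2 G =
  mk⇔ (λ ke → KE⇒diadem≡corona G ke , KE⇒∣core∣+∣corona∣≡2α G ke) (λ (eq , sizes) → diadem≡corona⇒KE G eq sizes) ,
  mk⇔ (λ ke → KE⇒corona-critical G ke , KE⇒∣core∣+∣corona∣≡2α G ke) (λ (crit , sizes) → corona-critical⇒KE G crit sizes)
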